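{- Let $\mathbb{K}$ be a field of characteristic $0$, $X$ a countable alphabet and $\Box$ a weak shuffle product on $\mathbb{K}\langle X\rangle$ with associated maps $f_1,f_2$. Let $T=\{a\in X: f_1(a\otimes a)\in\mathbb{K}\setminus\{0,1\}\}$ and assume $T\neq\emptyset$. Then $T=\{a\}$ is a singleton. Moreover, let $\Box'$ be the product defined by the same recursion with maps $f_1',f_2'$ given by $f_1'(x\otimes y)=f_1(x\otimes y)$ and $f_2'(x\otimes y)=f_2(x\otimes y)$ for all $(x,y)\in X^2\setminus\{(a,a)\}$, and $f_1'(a\otimes a)=f_2'(a\otimes a)=1$. Then $\Box'$ is a weak shuffle product and there exists an algebra isomorphism between $(\mathbb{K}\langle X\rangle,\Box)$ and $(\mathbb{K}\langle X\rangle,\Box')$.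
   Context: An alphabet is a non-empty finite or countable set $X$; $X^*$ is the set of words (empty word $1$), $\mathbb{K}\langle X\rangle$ the vector space with basis $X^*$, juxtaposition is concatenation. A weak shuffle product on $\mathbb{K}\langle X\rangle$ is an associative and commutative bilinear product $\Box$ with $u\Box 1=1\Box u=u$ and $au\Box bv=f_1(a\otimes b)\,a(u\Box bv)+f_2(a\otimes b)\,b(au\Box v)$ for all letters $a,b$ and words $u,v$, where $f_1,f_2:\mathbb{K}.X\otimes\mathbb{K}.X\to\mathbb{K}$ are linear maps. -}

module Defs where

open import Level using (Level; _⊔_)
open import Algebra.Bundles using (CommutativeRing)
open import Data.Nat using (ℕ; zero; suc)
import Data.Nat.Properties as ℕP
open import Data.List using (List; []; _∷_; _++_; map; concatMap)
import Data.List.Properties as LP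
open import Data.Product using (_×_; _,_; ∃; Σ)
open import Data.Bool using (if_then_else_)
open import Relation.Nullary using (¬_; yes; no; does)
open import Relation.Binary.Definitions using (DecidableEquality)
open import Relation.Binary.PropositionalEquality using (_≡_; cong)
open import Function.Definitions using (Injective)

-- Fields of characteristic 0 (the stdlib has no Field bundle):
-- a commutative ring with 0 ≠ 1 in which every nonzero element is
-- invertible, and in which n·1 ≠ 0 for every n ≥ 1.

module _ {c ℓ : Level} (R : CommutativeRing c ℓ) where
  open CommutativeRing R

  record IsField : Set (c ⊔ ℓ) where
    field
      0≉1     : ¬ (0# ≈ 1#)
      inverse : ∀ x → ¬ (x ≈ 0#) → ∃ λ y → x * y ≈ 1#

  ofℕ : ℕ → Carrier
  ofℕ zero    = 0#
  ofℕ (suc n) = 1# + ofℕ n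

  CharZero : Set ℓ
  CharZero = ∀ n → ¬ (ofℕ (suc n) ≈ 0#)

-- Countable alphabets: a type with an injection into ℕ.
-- Decidable equality follows.

decEqCountable : {X : Set} (ι : X → ℕ) → Injective _≡_ _≡_ ι → DecidableEquality X
decEqCountable ι inj x y with ι x ℕP.≟ ι y
... | yes p = yes (inj p)
... | no ¬p = no (λ e → ¬p (cong ι e))

-- The free algebra 𝕂⟨X⟩: finite formal linear combinations of words,
-- compared by their coefficient functions X* → 𝕂.

module FreeAlg {c ℓ : Level} (R : CommutativeRing c ℓ)
               {X : Set} (_≟X_ : DecidableEquality X) where
  open CommutativeRing R

  Word : Set
  Word = List X

  _≟W_ : DecidableEquality Word
  _≟W_ = LP.≡-dec _≟X_

  Poly : Set c
  Poly = List (Carrier × Word)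

  coeff : Poly → Word → Carrier
  coeff []             w = 0#
  coeff ((k , u) ∷ p)  w = (if does (u ≟W w) then k else 0#) + coeff p w

  _≋_ : Poly → Poly → Set ℓ
  p ≋ q = ∀ w → coeff p w ≈ coeff q w

  zeroP : Poly
  zeroP = []

  oneP : Poly
  oneP = (1# , []) ∷ []

  word : Word → Poly
  word w = (1# , w) ∷ []

  _⊕_ : Poly → Poly → Poly
  p ⊕ q = p ++ q

  _·_ : Carrier → Poly → Poly
  k · p = map (λ { (l , u) → (k * l , u) }) p

  _◁_ : X → Poly → Poly
  a ◁ p = map (λ { (l , u) → (l , a ∷ u) }) p

  -- linear maps 𝕂.X ⊗ 𝕂.X → 𝕂 are given by their values on the basis X × X
  Coef : Set c
  Coef = X → X → Carrier

  shw : Coef → Coef → Word → Word → Poly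
  shw f₁ f₂ []       v        = word v
  shw f₁ f₂ (a ∷ u)  []       = word (a ∷ u)
  shw f₁ f₂ (a ∷ u)  (b ∷ v)  =
    (f₁ a b · (a ◁ shw f₁ f₂ u (b ∷ v))) ⊕ (f₂ a b · (b ◁ shw f₁ f₂ (a ∷ u) v))

  sh : Coef → Coef → Poly → Poly → Poly
  sh f₁ f₂ p q =
    concatMap (λ { (k , u) → concatMap (λ { (l , v) → (k * l) · shw f₁ f₂ u v }) q }) p

  -- (f₁ , f₂) defines a weak shuffle product: the bilinear product given by
  -- the recursion above is associative and commutative (it is unital by
  -- construction).
  record IsWeakShuffle (f₁ f₂ : Coef) : Set (c ⊔ ℓ) where
    field
      assoc : ∀ p q r → sh f₁ f₂ (sh f₁ f₂ p q) r ≋ sh f₁ f₂ p (sh f₁ f₂ q r)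
      comm  : ∀ p q → sh f₁ f₂ p q ≋ sh f₁ f₂ q p

  record AlgIso (f₁ f₂ g₁ g₂ : Coef) : Set (c ⊔ ℓ) where
    field
      to       : Poly → Poly
      from     : Poly → Poly
      to-cong  : ∀ p q → p ≋ q → to p ≋ to q
      from-cong : ∀ p q → p ≋ q → from p ≋ from q
      to-from  : ∀ p → to (from p) ≋ p
      from-to  : ∀ p → from (to p) ≋ p
      to-+     : ∀ p q → to (p ⊕ q) ≋ (to p ⊕ to q)
      to-·     : ∀ k p → to (k · p) ≋ (k · to p)
      to-mul   : ∀ p q → to (sh f₁ f₂ p q) ≋ sh g₁ g₂ (to p) (to q)
      to-one   : to oneP ≋ oneP

  InT : Coef → X → Set ℓ
  InT f₁ a = ¬ (f₁ a a ≈ 0#) × ¬ (f₁ a a ≈ 1#)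

  modify : X → Coef → Coef
  modify a f x y with x ≟X a | y ≟X a
  ... | yes _ | yes _ = 1#
  ... | _     | _     = f x y

module Submission where

open import Defs
open import Level using (Level)
open import Algebra.Bundles using (CommutativeRing)
import Algebra.Solver.Ring
open import Algebra.Solver.Ring.AlmostCommutativeRing using (fromCommutativeRing; _-Raw-AlmostCommutative⟶_)
open import Data.Bool using (true; false; if_then_else_)
open import Data.Empty using (⊥-elim)
open import Data.Integer as ℤ using (ℤ; +_; -[1+_]; _⊖_)
import Data.Integer.Properties as ℤP
open import Data.List as List using (List; []; _∷_; _++_; length)
import Data.List.Properties as LP
open import Data.List.Relation.Unary.All using (All; []; _∷_)
open import Data.Maybe using (Maybe; just; nothing)
open import Data.Nat as ℕ using (ℕ; zero; suc)
import Data.Nat.Properties as ℕP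
open import Data.Product using (_×_; _,_; proj₁; proj₂)
open import Data.Sign as Sign using (Sign)
open import Data.Unit.Polymorphic using (⊤)
open import Function using (case_of_)
open import Function.Definitions using (Injective)
open import Relation.Binary.Bundles using (Setoid)
open import Relation.Binary.Definitions using (DecidableEquality)
open import Relation.Binary.PropositionalEquality as ≡ using (_≡_; _≢_)
import Relation.Binary.Reasoning.Setoid
open import Relation.Nullary using (¬_; yes; no; does)
open import Relation.Nullary.Decidable using (dec-true; dec-false)

-- Let a ∈ T, q = f₁(a,a) and p = f₂(a,a).
--
-- 1. Powers of a multiply as aⁿ □ aᵐ = κ(n,m) aⁿ⁺ᵐ, where κ is the
--    (q,p)-Pascal recursion.  Commutativity and associativity turn into
--    polynomial equations for κ, and an explicit certificate in ℤ[q,p]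
--    shows that they force q + p = 1 when q ∉ {0,1} and 3 ≠ 0.
-- 2. For b ≠ a, comparing the coefficients of aab, aba and aaab in two
--    associativity instances forces f₁(a,b) = f₂(b,a) = 1 and
--    f₂(a,b) = f₁(b,a) = 0.  A second letter b of T would thus have
--    f₁(b,a) equal to both 0 and 1, so T = {a}.
-- 3. With these values the leading a-runs of two words merge with
--    coefficient κ(n,m), which is 1 for □ (as q + p = 1) and the binomial
--    coefficient for □'.  Scaling each word by the product of n! over its
--    maximal runs aⁿ is therefore multiplicative from □ to □'; being a
--    diagonal rescaling by invertible weights, it is an algebra
--    isomorphism, and it transports associativity and commutativity to □'.

-- A ring solver with integer coefficients for an arbitrary commutative
-- ring: integers are interpreted through the canonical map ℤ → R.
module IntegerSolver {c ℓ : Level} (R : CommutativeRing c ℓ) where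
  open CommutativeRing R
  open import Algebra.Properties.Ring ring using (-‿distribˡ-*; -‿involutive; -‿+-comm; -0#≈0#)
  open import Algebra.Properties.Semiring.Mult.TCOptimised semiring
    using (1+×; ×-homo-+; ×1-homo-*)
    renaming (_×_ to _×ₙ_)
  open import Relation.Binary.Reasoning.Setoid setoid

  -- the canonical map; 0 and 1 go to 0# and 1# definitionally
  ⟦_⟧ℤ : ℤ → Carrier
  ⟦ + n ⟧ℤ     = n ×ₙ 1#
  ⟦ -[1+ n ] ⟧ℤ = - (suc n ×ₙ 1#)

  ⊖-homo : ∀ m n → ⟦ m ⊖ n ⟧ℤ ≈ m ×ₙ 1# - n ×ₙ 1#
  ⊖-homo zero    zero    = sym (trans (+-congˡ -0#≈0#) (+-identityʳ _))
  ⊖-homo zero    (suc n) = sym (+-identityˡ _)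
  ⊖-homo (suc m) zero    = sym (trans (+-congˡ -0#≈0#) (+-identityʳ _))
  ⊖-homo (suc m) (suc n) = begin
    ⟦ suc m ⊖ suc n ⟧ℤ             ≡⟨ ≡.cong ⟦_⟧ℤ (ℤP.[1+m]⊖[1+n]≡m⊖n m n) ⟩
    ⟦ m ⊖ n ⟧ℤ                     ≈⟨ ⊖-homo m n ⟩
    M - N                          ≈⟨ +-congˡ (-‿cong (+-identityˡ N)) ⟨
    M - (0# + N)                   ≈⟨ +-congˡ (-‿cong (+-congʳ (-‿inverseˡ 1#))) ⟨
    M - ((- 1# + 1#) + N)          ≈⟨ +-congˡ (-‿cong (+-assoc _ _ _)) ⟩
    M - (- 1# + (1# + N))          ≈⟨ +-congˡ (-‿+-comm _ _) ⟨
    M + (- - 1# + - (1# + N))      ≈⟨ +-congˡ (+-congʳ (-‿involutive 1#)) ⟩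
    M + (1# + - (1# + N))          ≈⟨ +-assoc _ _ _ ⟨
    (M + 1#) + - (1# + N)          ≈⟨ +-congʳ (+-comm _ _) ⟩
    (1# + M) - (1# + N)            ≈⟨ +-cong (1+× m 1#) (-‿cong (1+× n 1#)) ⟨
    suc m ×ₙ 1# - suc n ×ₙ 1#        ∎
    where
    M N : Carrier
    M = m ×ₙ 1#; N = n ×ₙ 1#

  -‿homo : ∀ i → ⟦ ℤ.- i ⟧ℤ ≈ - ⟦ i ⟧ℤ
  -‿homo -[1+ n ]    = sym (-‿involutive _)
  -‿homo (+ zero)    = sym -0#≈0#
  -‿homo (+ suc n)   = refl

  +-homo : ∀ i j → ⟦ i ℤ.+ j ⟧ℤ ≈ ⟦ i ⟧ℤ + ⟦ j ⟧ℤ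
  +-homo -[1+ m ] -[1+ n ] = begin
    - (suc (suc (m ℕ.+ n)) ×ₙ 1#)          ≡⟨ ≡.cong (λ k → - (k ×ₙ 1#)) (≡.cong suc (ℕP.+-suc m n)) ⟨
    - ((suc m ℕ.+ suc n) ×ₙ 1#)            ≈⟨ -‿cong (×-homo-+ 1# (suc m) (suc n)) ⟩
    - (suc m ×ₙ 1# + suc n ×ₙ 1#)           ≈⟨ -‿+-comm _ _ ⟨
    - (suc m ×ₙ 1#) + - (suc n ×ₙ 1#)       ∎
  +-homo -[1+ m ] (+ n)    = trans (⊖-homo n (suc m)) (+-comm _ _)
  +-homo (+ m)    -[1+ n ] = ⊖-homo m (suc n)
  +-homo (+ m)    (+ n)    = ×-homo-+ 1# m n

  -- signs as ring elements, used to reduce multiplication to ℕ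
  ⟦_⟧ₛ : Sign → Carrier
  ⟦ Sign.+ ⟧ₛ = 1#
  ⟦ Sign.- ⟧ₛ = - 1#

  ◃-homo : ∀ s n → ⟦ s ℤ.◃ n ⟧ℤ ≈ ⟦ s ⟧ₛ * (n ×ₙ 1#)
  ◃-homo s        zero    = sym (zeroʳ _)
  ◃-homo Sign.+   (suc n) = sym (*-identityˡ _)
  ◃-homo Sign.-   (suc n) = trans (-‿cong (sym (*-identityˡ _))) (-‿distribˡ-* _ _)

  sign-homo : ∀ s t → ⟦ s Sign.* t ⟧ₛ ≈ ⟦ s ⟧ₛ * ⟦ t ⟧ₛ
  sign-homo Sign.- Sign.- = sym (trans (sym (-‿distribˡ-* 1# (- 1#))) (trans (-‿cong (*-identityˡ _)) (-‿involutive _)))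
  sign-homo Sign.- Sign.+ = sym (*-identityʳ _)
  sign-homo Sign.+ t      = sym (*-identityˡ _)

  signAbs-homo : ∀ i → ⟦ i ⟧ℤ ≈ ⟦ ℤ.sign i ⟧ₛ * (ℤ.∣ i ∣ ×ₙ 1#)
  signAbs-homo (+ n)    = sym (*-identityˡ _)
  signAbs-homo -[1+ n ] = trans (-‿cong (sym (*-identityˡ _))) (-‿distribˡ-* _ _)

  *-homo : ∀ i j → ⟦ i ℤ.* j ⟧ℤ ≈ ⟦ i ⟧ℤ * ⟦ j ⟧ℤ
  *-homo i j = begin
    ⟦ (s Sign.* t) ℤ.◃ (m ℕ.* n) ⟧ℤ      ≈⟨ ◃-homo (s Sign.* t) (m ℕ.* n) ⟩
    ⟦ s Sign.* t ⟧ₛ * ((m ℕ.* n) ×ₙ 1#)   ≈⟨ *-cong (sign-homo s t) (×1-homo-* m n) ⟩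
    (⟦ s ⟧ₛ * ⟦ t ⟧ₛ) * (M * N)          ≈⟨ interchange ⟩
    (⟦ s ⟧ₛ * M) * (⟦ t ⟧ₛ * N)          ≈⟨ *-cong (signAbs-homo i) (signAbs-homo j) ⟨
    ⟦ i ⟧ℤ * ⟦ j ⟧ℤ                      ∎
    where
    s t : Sign
    s = ℤ.sign i; t = ℤ.sign j
    m n : ℕ
    m = ℤ.∣ i ∣; n = ℤ.∣ j ∣
    M N : Carrier
    M = m ×ₙ 1#; N = n ×ₙ 1#
    interchange : (⟦ s ⟧ₛ * ⟦ t ⟧ₛ) * (M * N) ≈ (⟦ s ⟧ₛ * M) * (⟦ t ⟧ₛ * N)
    interchange = begin
      (⟦ s ⟧ₛ * ⟦ t ⟧ₛ) * (M * N)   ≈⟨ *-assoc _ _ _ ⟩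
      ⟦ s ⟧ₛ * (⟦ t ⟧ₛ * (M * N))   ≈⟨ *-congˡ (*-assoc _ _ _) ⟨
      ⟦ s ⟧ₛ * ((⟦ t ⟧ₛ * M) * N)   ≈⟨ *-congˡ (*-congʳ (*-comm _ _)) ⟩
      ⟦ s ⟧ₛ * ((M * ⟦ t ⟧ₛ) * N)   ≈⟨ *-congˡ (*-assoc _ _ _) ⟩
      ⟦ s ⟧ₛ * (M * (⟦ t ⟧ₛ * N))   ≈⟨ *-assoc _ _ _ ⟨
      (⟦ s ⟧ₛ * M) * (⟦ t ⟧ₛ * N)   ∎

  ℤ→R : ℤ.+-*-rawRing -Raw-AlmostCommutative⟶ fromCommutativeRing R
  ℤ→R = record
    { ⟦_⟧ = ⟦_⟧ℤ ; +-homo = +-homo ; *-homo = *-homo ; -‿homo = -‿homo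
    ; 0-homo = refl ; 1-homo = refl }

  _≟ℤ_ : ∀ i j → Maybe (⟦ i ⟧ℤ ≈ ⟦ j ⟧ℤ)
  i ≟ℤ j with i ℤ.≟ j
  ... | yes ≡.refl = just refl
  ... | no _       = nothing

  open Algebra.Solver.Ring ℤ.+-*-rawRing (fromCommutativeRing R) ℤ→R _≟ℤ_ public

  num : ∀ {n} → ℕ → Polynomial n
  num i = con (ℤ.+ i)

module FieldFacts {c ℓ : Level} (R : CommutativeRing c ℓ) (isField : IsField R) (charZero : CharZero R) where
  open CommutativeRing R
  open IsField isField
  open import Algebra.Properties.Semiring.Mult.TCOptimised semiring using (×ᵤ≈×)
  open import Relation.Binary.Reasoning.Setoid setoid

  cancel : ∀ {x y} → ¬ x ≈ 0# → x * y ≈ 0# → y ≈ 0#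
  cancel {x} {y} x≉0 xy≈0 with inverse x x≉0
  ... | (x⁻¹ , xx⁻¹≈1) = begin
    y                ≈⟨ *-identityˡ y ⟨
    1# * y           ≈⟨ *-congʳ (trans (sym xx⁻¹≈1) (*-comm _ _)) ⟩
    (x⁻¹ * x) * y    ≈⟨ *-assoc _ _ _ ⟩
    x⁻¹ * (x * y)    ≈⟨ *-congˡ xy≈0 ⟩
    x⁻¹ * 0#         ≈⟨ zeroʳ _ ⟩
    0#               ∎

  *-nonzero : ∀ {x y} → ¬ x ≈ 0# → ¬ y ≈ 0# → ¬ (x * y) ≈ 0#
  *-nonzero x≉0 y≉0 xy≈0 = y≉0 (cancel x≉0 xy≈0)

  -- the numeral 3 as the solver writes it, (1 + 1) + 1
  three≉0 : ¬ (1# + 1#) + 1# ≈ 0#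
  three≉0 3≈0 = charZero 2 (trans (×ᵤ≈× 3 1#) 3≈0)

module Calculus {c ℓ : Level} (R : CommutativeRing c ℓ) {X : Set} (_≟X_ : DecidableEquality X) where
  open CommutativeRing R
  open FreeAlg R _≟X_
  open import Algebra.Properties.Ring ring using (-1*x≈-x; x∙y⁻¹≈ε⇒x≈y; x≈y⇒x∙y⁻¹≈ε)
  open Relation.Binary.Reasoning.Setoid setoid

  δ : X → X → Carrier → Carrier
  δ x z k = if does (x ≟X z) then k else 0#

  δ-cong : ∀ x z {k k'} → k ≈ k' → δ x z k ≈ δ x z k'
  δ-cong x z k≈k' with does (x ≟X z)
  ... | true  = k≈k'
  ... | false = refl

  coeff-hit : ∀ k u p w → u ≡ w → coeff ((k , u) ∷ p) w ≈ k + coeff p w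
  coeff-hit k u p w u≡w rewrite dec-true (u ≟W w) u≡w = refl

  coeff-miss : ∀ k u p w → u ≢ w → coeff ((k , u) ∷ p) w ≈ coeff p w
  coeff-miss k u p w u≢w rewrite dec-false (u ≟W w) u≢w = +-identityˡ _

  coeff-++ : ∀ p q w → coeff (p ⊕ q) w ≈ coeff p w + coeff q w
  coeff-++ []            q w = sym (+-identityˡ _)
  coeff-++ ((k , u) ∷ p) q w = trans (+-congˡ (coeff-++ p q w)) (sym (+-assoc _ _ _))

  coeff-· : ∀ k p w → coeff (k · p) w ≈ k * coeff p w
  coeff-· k []            w = sym (zeroʳ _)
  coeff-· k ((l , u) ∷ p) w with does (u ≟W w)
  ... | true  = trans (+-congˡ (coeff-· k p w)) (sym (distribˡ _ _ _))
  ... | false = trans (+-cong (sym (zeroʳ k)) (coeff-· k p w)) (sym (distribˡ _ _ _))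

  coeff-◁-[] : ∀ x p → coeff (x ◁ p) [] ≈ 0#
  coeff-◁-[] x []            = refl
  coeff-◁-[] x ((l , u) ∷ p) = trans (coeff-miss l (x ∷ u) (x ◁ p) [] (λ ())) (coeff-◁-[] x p)

  coeff-◁-same : ∀ x p w → coeff (x ◁ p) (x ∷ w) ≈ coeff p w
  coeff-◁-same x []            w = refl
  coeff-◁-same x ((l , u) ∷ p) w = case u ≟W w of λ
    { (yes u≡w) → begin
        coeff ((l , x ∷ u) ∷ (x ◁ p)) (x ∷ w)  ≈⟨ coeff-hit l (x ∷ u) (x ◁ p) (x ∷ w) (≡.cong (x ∷_) u≡w) ⟩
        l + coeff (x ◁ p) (x ∷ w)             ≈⟨ +-congˡ (coeff-◁-same x p w) ⟩
        l + coeff p w                         ≈⟨ coeff-hit l u p w u≡w ⟨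
        coeff ((l , u) ∷ p) w                 ∎
    ; (no u≢w) → begin
        coeff ((l , x ∷ u) ∷ (x ◁ p)) (x ∷ w)  ≈⟨ coeff-miss l (x ∷ u) (x ◁ p) (x ∷ w) (λ { ≡.refl → u≢w ≡.refl }) ⟩
        coeff (x ◁ p) (x ∷ w)                 ≈⟨ coeff-◁-same x p w ⟩
        coeff p w                             ≈⟨ coeff-miss l u p w u≢w ⟨
        coeff ((l , u) ∷ p) w                 ∎ }

  coeff-◁-other : ∀ x p z w → x ≢ z → coeff (x ◁ p) (z ∷ w) ≈ 0#
  coeff-◁-other x []            z w x≢z = refl
  coeff-◁-other x ((l , u) ∷ p) z w x≢z =
    trans (coeff-miss l (x ∷ u) (x ◁ p) (z ∷ w) (λ { ≡.refl → x≢z ≡.refl })) (coeff-◁-other x p z w x≢z)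

  coeff-◁ : ∀ x p z w → coeff (x ◁ p) (z ∷ w) ≈ δ x z (coeff p w)
  coeff-◁ x p z w with x ≟X z
  ... | yes ≡.refl = coeff-◁-same x p w
  ... | no  x≢z    = coeff-◁-other x p z w x≢z

  -- Equality of polynomials wrapped in a record: unlike _≋_, whose
  -- unfolding hides its arguments, _≃_ lets Agda infer the polynomials
  -- in the congruence lemmas below from the types of their premises.
  record _≃_ (p q : Poly) : Set ℓ where
    constructor by-coeff
    field coeff-≈ : p ≋ q
  open _≃_ public

  ≃-setoid : Setoid c ℓ
  ≃-setoid = record
    { Carrier = Poly ; _≈_ = _≃_
    ; isEquivalence = record
      { refl  = by-coeff λ w → refl
      ; sym   = λ p≃q → by-coeff λ w → sym (coeff-≈ p≃q w)
      ; trans = λ p≃q q≃r → by-coeff λ w → trans (coeff-≈ p≃q w) (coeff-≈ q≃r w) } }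

  open Setoid ≃-setoid public using () renaming (refl to ≃-refl; sym to ≃-sym; trans to ≃-trans)
  module ≃-Reasoning = Relation.Binary.Reasoning.Setoid ≃-setoid

  ≡⇒≃ : ∀ {p q} → p ≡ q → p ≃ q
  ≡⇒≃ ≡.refl = ≃-refl

  ⊕-cong : ∀ {p p' q q'} → p ≃ p' → q ≃ q' → (p ⊕ q) ≃ (p' ⊕ q')
  ⊕-cong {p} {p'} {q} {q'} p≃p' q≃q' = by-coeff λ w →
    trans (coeff-++ p q w) (trans (+-cong (coeff-≈ p≃p' w) (coeff-≈ q≃q' w)) (sym (coeff-++ p' q' w)))

  ·-cong : ∀ {k k' p p'} → k ≈ k' → p ≃ p' → (k · p) ≃ (k' · p')
  ·-cong {k} {k'} {p} {p'} k≈k' p≃p' = by-coeff λ w →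
    trans (coeff-· k p w) (trans (*-cong k≈k' (coeff-≈ p≃p' w)) (sym (coeff-· k' p' w)))

  ·-congˡ : ∀ k {p p'} → p ≃ p' → (k · p) ≃ (k · p')
  ·-congˡ k = ·-cong refl

  ◁-cong : ∀ x {p q} → p ≃ q → (x ◁ p) ≃ (x ◁ q)
  ◁-cong x {p} {q} p≃q = by-coeff λ
    { []      → trans (coeff-◁-[] x p) (sym (coeff-◁-[] x q))
    ; (z ∷ w) → trans (coeff-◁ x p z w) (trans (δ-cong x z (coeff-≈ p≃q w)) (sym (coeff-◁ x q z w))) }

  ∷-cong : ∀ {k k'} u {p q} → k ≈ k' → p ≃ q → ((k , u) ∷ p) ≃ ((k' , u) ∷ q)
  ∷-cong {k} {k'} u {p} {q} k≈k' p≃q = by-coeff λ w → case u ≟W w of λ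
    { (yes u≡w) → trans (coeff-hit k u p w u≡w) (trans (+-cong k≈k' (coeff-≈ p≃q w)) (sym (coeff-hit k' u q w u≡w)))
    ; (no  u≢w) → trans (coeff-miss k u p w u≢w) (trans (coeff-≈ p≃q w) (sym (coeff-miss k' u q w u≢w))) }

  ·-assoc : ∀ k l p → (k · (l · p)) ≃ ((k * l) · p)
  ·-assoc k l p = by-coeff λ w → begin
    coeff (k · (l · p)) w   ≈⟨ coeff-· k (l · p) w ⟩
    k * coeff (l · p) w     ≈⟨ *-congˡ (coeff-· l p w) ⟩
    k * (l * coeff p w)     ≈⟨ *-assoc _ _ _ ⟨
    (k * l) * coeff p w     ≈⟨ coeff-· (k * l) p w ⟨
    coeff ((k * l) · p) w   ∎

  ·-exchange : ∀ {k l k' l'} p → k * l ≈ k' * l' → (k · (l · p)) ≃ (k' · (l' · p))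
  ·-exchange {k} {l} {k'} {l'} p kl≈k'l' =
    ≃-trans (·-assoc k l p) (≃-trans (·-cong kl≈k'l' ≃-refl) (≃-sym (·-assoc k' l' p)))

  ·-identity : ∀ p → (1# · p) ≃ p
  ·-identity p = by-coeff λ w → trans (coeff-· 1# p w) (*-identityˡ _)

  ·-distribʳ : ∀ k l p → ((k · p) ⊕ (l · p)) ≃ ((k + l) · p)
  ·-distribʳ k l p = by-coeff λ w → begin
    coeff ((k · p) ⊕ (l · p)) w          ≈⟨ coeff-++ (k · p) (l · p) w ⟩
    coeff (k · p) w + coeff (l · p) w    ≈⟨ +-cong (coeff-· k p w) (coeff-· l p w) ⟩
    k * coeff p w + l * coeff p w        ≈⟨ distribʳ _ _ _ ⟨
    (k + l) * coeff p w                  ≈⟨ coeff-· (k + l) p w ⟨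
    coeff ((k + l) · p) w                ∎

  only-left : ∀ {k l} p q → k ≈ 1# → l ≈ 0# → ((k · p) ⊕ (l · q)) ≃ p
  only-left {k} {l} p q k≈1 l≈0 = by-coeff λ w → begin
    coeff ((k · p) ⊕ (l · q)) w        ≈⟨ coeff-++ (k · p) (l · q) w ⟩
    coeff (k · p) w + coeff (l · q) w  ≈⟨ +-cong (coeff-· k p w) (coeff-· l q w) ⟩
    k * coeff p w + l * coeff q w      ≈⟨ +-cong (*-congʳ k≈1) (*-congʳ l≈0) ⟩
    1# * coeff p w + 0# * coeff q w    ≈⟨ +-cong (*-identityˡ _) (zeroˡ _) ⟩
    coeff p w + 0#                     ≈⟨ +-identityʳ _ ⟩
    coeff p w                          ∎

  only-right : ∀ {k l} p q → k ≈ 0# → l ≈ 1# → ((k · p) ⊕ (l · q)) ≃ q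
  only-right {k} {l} p q k≈0 l≈1 = by-coeff λ w → begin
    coeff ((k · p) ⊕ (l · q)) w        ≈⟨ coeff-++ (k · p) (l · q) w ⟩
    coeff (k · p) w + coeff (l · q) w  ≈⟨ +-cong (coeff-· k p w) (coeff-· l q w) ⟩
    k * coeff p w + l * coeff q w      ≈⟨ +-cong (*-congʳ k≈0) (*-congʳ l≈1) ⟩
    0# * coeff p w + 1# * coeff q w    ≈⟨ +-cong (zeroˡ _) (*-identityˡ _) ⟩
    0# + coeff q w                     ≈⟨ +-identityˡ _ ⟩
    coeff q w                          ∎

  ◁-· : ∀ x k p → (x ◁ (k · p)) ≡ (k · (x ◁ p))
  ◁-· x k []            = ≡.refl
  ◁-· x k ((l , u) ∷ p) = ≡.cong ((k * l , x ∷ u) ∷_) (◁-· x k p)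

  ·-⊕ : ∀ k p q → (k · (p ⊕ q)) ≡ ((k · p) ⊕ (k · q))
  ·-⊕ k p q = LP.map-++ _ p q

  -- The linear form on 𝕂⟨X⟩ with values h on the basis of words.  Every
  -- coefficient of sh is such a form applied twice (sh-coeff below).
  eval : (Word → Carrier) → Poly → Carrier
  eval h []            = 0#
  eval h ((k , u) ∷ p) = k * h u + eval h p

  eval-++ : ∀ h p q → eval h (p ⊕ q) ≈ eval h p + eval h q
  eval-++ h []            q = sym (+-identityˡ _)
  eval-++ h ((k , u) ∷ p) q = trans (+-congˡ (eval-++ h p q)) (sym (+-assoc _ _ _))

  eval-· : ∀ h k p → eval h (k · p) ≈ k * eval h p
  eval-· h k []            = sym (zeroʳ _)
  eval-· h k ((l , u) ∷ p) = trans (+-cong (*-assoc _ _ _) (eval-· h k p)) (sym (distribˡ _ _ _))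

  eval-congʰ : ∀ {h h'} p → (∀ u → h u ≈ h' u) → eval h p ≈ eval h' p
  eval-congʰ []            h≈h' = refl
  eval-congʰ ((k , u) ∷ p) h≈h' = +-cong (*-congˡ (h≈h' u)) (eval-congʰ p h≈h')

  eval-scaleʰ : ∀ k h p → eval (λ u → k * h u) p ≈ k * eval h p
  eval-scaleʰ k h []            = sym (zeroʳ _)
  eval-scaleʰ k h ((l , u) ∷ p) = begin
    l * (k * h u) + eval (λ u → k * h u) p  ≈⟨ +-cong (sym (*-assoc _ _ _)) (eval-scaleʰ k h p) ⟩
    (l * k) * h u + k * eval h p            ≈⟨ +-congʳ (*-congʳ (*-comm l k)) ⟩
    (k * l) * h u + k * eval h p            ≈⟨ +-congʳ (*-assoc _ _ _) ⟩
    k * (l * h u) + k * eval h p            ≈⟨ distribˡ _ _ _ ⟨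
    k * (l * h u + eval h p)                ∎

  eval-word : ∀ h u → eval h (word u) ≈ h u
  eval-word h u = trans (+-identityʳ _) (*-identityˡ _)

  eval-·-word : ∀ h k u → eval h (k · word u) ≈ k * h u
  eval-·-word h k u = trans (+-identityʳ _) (*-congʳ (*-identityʳ _))

  -- Well-definedness of eval on 𝕂⟨X⟩.  Deleting all terms on a word u
  -- isolates its contribution, and a polynomial with zero coefficients
  -- evaluates to 0 by induction on its length.
  delete : Word → Poly → Poly
  delete u []            = []
  delete u ((l , v) ∷ p) with u ≟W v
  ... | yes _ = delete u p
  ... | no  _ = (l , v) ∷ delete u p

  delete-length : ∀ u p → length (delete u p) ℕ.≤ length p
  delete-length u []            = ℕ.z≤n
  delete-length u ((l , v) ∷ p) with u ≟W v
  ... | yes _ = ℕP.m≤n⇒m≤1+n (delete-length u p)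
  ... | no  _ = ℕ.s≤s (delete-length u p)

  coeff-delete-self : ∀ u p → coeff (delete u p) u ≈ 0#
  coeff-delete-self u []            = refl
  coeff-delete-self u ((l , v) ∷ p) with u ≟W v
  ... | yes _   = coeff-delete-self u p
  ... | no  u≢v = trans (coeff-miss l v (delete u p) u (λ v≡u → u≢v (≡.sym v≡u))) (coeff-delete-self u p)

  coeff-delete-other : ∀ u p w → u ≢ w → coeff (delete u p) w ≈ coeff p w
  coeff-delete-other u []            w u≢w = refl
  coeff-delete-other u ((l , v) ∷ p) w u≢w with u ≟W v
  ... | yes ≡.refl = trans (coeff-delete-other u p w u≢w) (sym (coeff-miss l u p w u≢w))
  ... | no  _      = +-congˡ (coeff-delete-other u p w u≢w)

  eval-delete : ∀ h u p → eval h p ≈ coeff p u * h u + eval h (delete u p)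
  eval-delete h u []            = sym (trans (+-congʳ (zeroˡ _)) (+-identityˡ _))
  eval-delete h u ((l , v) ∷ p) with u ≟W v
  ... | yes ≡.refl = begin
      l * h u + eval h p                                    ≈⟨ +-congˡ (eval-delete h u p) ⟩
      l * h u + (coeff p u * h u + eval h (delete u p))      ≈⟨ +-assoc _ _ _ ⟨
      (l * h u + coeff p u * h u) + eval h (delete u p)      ≈⟨ +-congʳ (distribʳ _ _ _) ⟨
      (l + coeff p u) * h u + eval h (delete u p)            ≈⟨ +-congʳ (*-congʳ (coeff-hit l u p u ≡.refl)) ⟨
      coeff ((l , u) ∷ p) u * h u + eval h (delete u p)      ∎
  ... | no u≢v = begin
      l * h v + eval h p                                    ≈⟨ +-congˡ (eval-delete h u p) ⟩
      l * h v + (coeff p u * h u + eval h (delete u p))      ≈⟨ x+[y+z]≈y+[x+z] _ _ _ ⟩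
      coeff p u * h u + (l * h v + eval h (delete u p))      ≈⟨ +-congʳ (*-congʳ (coeff-miss l v p u (λ v≡u → u≢v (≡.sym v≡u)))) ⟨
      coeff ((l , v) ∷ p) u * h u + (l * h v + eval h (delete u p)) ∎
    where
    x+[y+z]≈y+[x+z] : ∀ x y z → x + (y + z) ≈ y + (x + z)
    x+[y+z]≈y+[x+z] x y z = trans (sym (+-assoc _ _ _)) (trans (+-congʳ (+-comm x y)) (+-assoc _ _ _))

  eval-null : ∀ h p → (∀ w → coeff p w ≈ 0#) → eval h p ≈ 0#
  eval-null h p = go (length p) p ℕP.≤-refl
    where
    go : ∀ n p → length p ℕ.≤ n → (∀ w → coeff p w ≈ 0#) → eval h p ≈ 0#
    go n       []            _           _     = refl
    go (suc n) ((k , u) ∷ p) (ℕ.s≤s |p|≤n) null = begin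
      k * h u + eval h p                                  ≈⟨ +-congˡ (eval-delete h u p) ⟩
      k * h u + (coeff p u * h u + eval h (delete u p))    ≈⟨ +-assoc _ _ _ ⟨
      (k * h u + coeff p u * h u) + eval h (delete u p)    ≈⟨ +-congʳ (distribʳ _ _ _) ⟨
      (k + coeff p u) * h u + eval h (delete u p)          ≈⟨ +-congʳ (*-congʳ (trans (sym (coeff-hit k u p u ≡.refl)) (null u))) ⟩
      0# * h u + eval h (delete u p)                      ≈⟨ trans (+-congʳ (zeroˡ _)) (+-identityˡ _) ⟩
      eval h (delete u p)                                 ≈⟨ go n (delete u p) (ℕP.≤-trans (delete-length u p) |p|≤n) null' ⟩
      0#                                                  ∎
      where
      null' : ∀ w → coeff (delete u p) w ≈ 0#
      null' w with u ≟W w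
      ... | yes ≡.refl = coeff-delete-self u p
      ... | no  u≢w    = trans (coeff-delete-other u p w u≢w) (trans (sym (coeff-miss k u p w u≢w)) (null w))

  eval-cong : ∀ h {p q} → p ≃ q → eval h p ≈ eval h q
  eval-cong h {p} {q} p≃q = x∙y⁻¹≈ε⇒x≈y _ _ (begin
    eval h p - eval h q                 ≈⟨ +-congˡ (-1*x≈-x _) ⟨
    eval h p + - 1# * eval h q          ≈⟨ +-congˡ (eval-· h (- 1#) q) ⟨
    eval h p + eval h ((- 1#) · q)        ≈⟨ eval-++ h p ((- 1#) · q) ⟨
    eval h (p ⊕ ((- 1#) · q))             ≈⟨ eval-null h (p ⊕ ((- 1#) · q)) difference-null ⟩
    0#                                  ∎)
    where
    difference-null : ∀ w → coeff (p ⊕ ((- 1#) · q)) w ≈ 0#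
    difference-null w = begin
      coeff (p ⊕ ((- 1#) · q)) w           ≈⟨ coeff-++ p ((- 1#) · q) w ⟩
      coeff p w + coeff ((- 1#) · q) w     ≈⟨ +-congˡ (trans (coeff-· (- 1#) q w) (-1*x≈-x _)) ⟩
      coeff p w - coeff q w              ≈⟨ x≈y⇒x∙y⁻¹≈ε (coeff-≈ p≃q w) ⟩
      0#                                 ∎

  coeff-concatMap : ∀ (G : Carrier × Word → Poly) (h : Word → Carrier) w
    → (∀ k u → coeff (G (k , u)) w ≈ k * h u)
    → ∀ p → coeff (List.concatMap G p) w ≈ eval h p
  coeff-concatMap G h w G≈ []            = refl
  coeff-concatMap G h w G≈ ((k , u) ∷ p) =
    trans (coeff-++ (G (k , u)) (List.concatMap G p) w) (+-cong (G≈ k u) (coeff-concatMap G h w G≈ p))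

  sh-coeff : ∀ f₁ f₂ p q w → coeff (sh f₁ f₂ p q) w ≈ eval (λ u → eval (λ v → coeff (shw f₁ f₂ u v) w) q) p
  sh-coeff f₁ f₂ p q w = coeff-concatMap _ _ w inner p
    where
    inner : ∀ k u → coeff (List.concatMap (λ { (l , v) → (k * l) · shw f₁ f₂ u v }) q) w
                    ≈ k * eval (λ v → coeff (shw f₁ f₂ u v) w) q
    inner k u = trans (coeff-concatMap _ (λ v → k * coeff (shw f₁ f₂ u v) w) w scalar q)
                      (eval-scaleʰ k (λ v → coeff (shw f₁ f₂ u v) w) q)
      where
      scalar : ∀ l v → coeff ((k * l) · shw f₁ f₂ u v) w ≈ l * (k * coeff (shw f₁ f₂ u v) w)
      scalar l v = trans (coeff-· (k * l) (shw f₁ f₂ u v) w)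
                         (trans (*-congʳ (*-comm k l)) (*-assoc _ _ _))

  sh-cong : ∀ f₁ f₂ {p p' q q'} → p ≃ p' → q ≃ q' → sh f₁ f₂ p q ≃ sh f₁ f₂ p' q'
  sh-cong f₁ f₂ {p} {p'} {q} {q'} p≃p' q≃q' = by-coeff λ w → begin
    coeff (sh f₁ f₂ p q) w                                        ≈⟨ sh-coeff f₁ f₂ p q w ⟩
    eval (λ u → eval (λ v → coeff (shw f₁ f₂ u v) w) q) p          ≈⟨ eval-congʰ p (λ u → eval-cong _ q≃q') ⟩
    eval (λ u → eval (λ v → coeff (shw f₁ f₂ u v) w) q') p         ≈⟨ eval-cong _ p≃p' ⟩
    eval (λ u → eval (λ v → coeff (shw f₁ f₂ u v) w) q') p'        ≈⟨ sh-coeff f₁ f₂ p' q' w ⟨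
    coeff (sh f₁ f₂ p' q') w                                      ∎

  sh-word : ∀ f₁ f₂ u v → sh f₁ f₂ (word u) (word v) ≃ shw f₁ f₂ u v
  sh-word f₁ f₂ u v = by-coeff λ w →
    trans (sh-coeff f₁ f₂ (word u) (word v) w)
          (trans (+-identityʳ _) (trans (*-identityˡ _) (trans (+-identityʳ _) (*-identityˡ _))))

  shw-coeff-∷ : ∀ f₁ f₂ x u y v z w →
    coeff (shw f₁ f₂ (x ∷ u) (y ∷ v)) (z ∷ w)
      ≈ f₁ x y * δ x z (coeff (shw f₁ f₂ u (y ∷ v)) w) + f₂ x y * δ y z (coeff (shw f₁ f₂ (x ∷ u) v) w)
  shw-coeff-∷ f₁ f₂ x u y v z w =
    trans (coeff-++ (f₁ x y · (x ◁ A)) (f₂ x y · (y ◁ B)) (z ∷ w))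
          (+-cong (trans (coeff-· (f₁ x y) (x ◁ A) (z ∷ w)) (*-congˡ (coeff-◁ x A z w)))
                  (trans (coeff-· (f₂ x y) (y ◁ B) (z ∷ w)) (*-congˡ (coeff-◁ y B z w))))
    where
    A B : Poly
    A = shw f₁ f₂ u (y ∷ v); B = shw f₁ f₂ (x ∷ u) v

  -- The coefficients of a word product as a function computed by the same
  -- recursion; once equality of letters is decided it evaluates to a
  -- closed expression in the structure constants.
  shwCoeff : Coef → Coef → Word → Word → Word → Carrier
  shwCoeff f₁ f₂ []      v       w       = coeff (word v) w
  shwCoeff f₁ f₂ (x ∷ u) []      w       = coeff (word (x ∷ u)) w
  shwCoeff f₁ f₂ (x ∷ u) (y ∷ v) []      = 0#
  shwCoeff f₁ f₂ (x ∷ u) (y ∷ v) (z ∷ w) =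
    f₁ x y * δ x z (shwCoeff f₁ f₂ u (y ∷ v) w) + f₂ x y * δ y z (shwCoeff f₁ f₂ (x ∷ u) v w)

  coeff-shw : ∀ f₁ f₂ u v w → coeff (shw f₁ f₂ u v) w ≈ shwCoeff f₁ f₂ u v w
  coeff-shw f₁ f₂ []      v       w       = refl
  coeff-shw f₁ f₂ (x ∷ u) []      w       = refl
  coeff-shw f₁ f₂ (x ∷ u) (y ∷ v) []      =
    trans (coeff-++ (f₁ x y · (x ◁ A)) (f₂ x y · (y ◁ B)) [])
          (trans (+-cong (trans (coeff-· (f₁ x y) (x ◁ A) []) (trans (*-congˡ (coeff-◁-[] x A)) (zeroʳ _)))
                         (trans (coeff-· (f₂ x y) (y ◁ B) []) (trans (*-congˡ (coeff-◁-[] y B)) (zeroʳ _))))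
                 (+-identityʳ _))
    where
    A B : Poly
    A = shw f₁ f₂ u (y ∷ v); B = shw f₁ f₂ (x ∷ u) v
  coeff-shw f₁ f₂ (x ∷ u) (y ∷ v) (z ∷ w) =
    trans (shw-coeff-∷ f₁ f₂ x u y v z w)
          (+-cong (*-congˡ (δ-cong x z (coeff-shw f₁ f₂ u (y ∷ v) w)))
                  (*-congˡ (δ-cong y z (coeff-shw f₁ f₂ (x ∷ u) v w))))

  module WordLaws (f₁ f₂ : Coef) (isWeakShuffle : IsWeakShuffle f₁ f₂) where
    open IsWeakShuffle isWeakShuffle

    comm-coeff : ∀ u v w → coeff (shw f₁ f₂ u v) w ≈ coeff (shw f₁ f₂ v u) w
    comm-coeff u v w = begin
      coeff (shw f₁ f₂ u v) w                 ≈⟨ coeff-≈ (sh-word f₁ f₂ u v) w ⟨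
      coeff (sh f₁ f₂ (word u) (word v)) w    ≈⟨ comm (word u) (word v) w ⟩
      coeff (sh f₁ f₂ (word v) (word u)) w    ≈⟨ coeff-≈ (sh-word f₁ f₂ v u) w ⟩
      coeff (shw f₁ f₂ v u) w                 ∎

    assoc-coeff : ∀ u v t w →
      eval (λ s → coeff (shw f₁ f₂ s t) w) (shw f₁ f₂ u v) ≈ eval (λ s → coeff (shw f₁ f₂ u s) w) (shw f₁ f₂ v t)
    assoc-coeff u v t w = begin
      eval (λ s → coeff (shw f₁ f₂ s t) w) (shw f₁ f₂ u v)
        ≈⟨ eval-cong _ (sh-word f₁ f₂ u v) ⟨
      eval (λ s → coeff (shw f₁ f₂ s t) w) (sh f₁ f₂ (word u) (word v))
        ≈⟨ eval-congʰ (sh f₁ f₂ (word u) (word v)) (λ s → eval-word (λ r → coeff (shw f₁ f₂ s r) w) t) ⟨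
      eval (λ s → eval (λ r → coeff (shw f₁ f₂ s r) w) (word t)) (sh f₁ f₂ (word u) (word v))
        ≈⟨ sh-coeff f₁ f₂ (sh f₁ f₂ (word u) (word v)) (word t) w ⟨
      coeff (sh f₁ f₂ (sh f₁ f₂ (word u) (word v)) (word t)) w
        ≈⟨ assoc (word u) (word v) (word t) w ⟩
      coeff (sh f₁ f₂ (word u) (sh f₁ f₂ (word v) (word t))) w
        ≈⟨ sh-coeff f₁ f₂ (word u) (sh f₁ f₂ (word v) (word t)) w ⟩
      eval (λ s → eval (λ r → coeff (shw f₁ f₂ s r) w) (sh f₁ f₂ (word v) (word t))) (word u)
        ≈⟨ eval-word (λ s → eval (λ r → coeff (shw f₁ f₂ s r) w) (sh f₁ f₂ (word v) (word t))) u ⟩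
      eval (λ s → coeff (shw f₁ f₂ u s) w) (sh f₁ f₂ (word v) (word t))
        ≈⟨ eval-cong _ (sh-word f₁ f₂ v t) ⟩
      eval (λ s → coeff (shw f₁ f₂ u s) w) (shw f₁ f₂ v t)
        ∎

-- The coefficients of aⁿ □ aᵐ for a weak shuffle product with
-- q = f₁(a⊗a), p = f₂(a⊗a): a (q,p)-analogue of the binomial coefficients,
--   c(0,m) = c(n,0) = 1,   c(n+1,m+1) = q c(n,m+1) + p c(n+1,m).
-- It is stated over arbitrary operations so that the same recursion
-- serves both in a ring and in the syntax of the ring solver.
pascal : ∀ {a} {A : Set a} → (A → A → A) → (A → A → A) → A → A → A → ℕ → ℕ → A
pascal _+_ _*_ one q p zero    m       = one
pascal _+_ _*_ one q p (suc n) zero    = one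
pascal _+_ _*_ one q p (suc n) (suc m) =
  (q * pascal _+_ _*_ one q p n (suc m)) + (p * pascal _+_ _*_ one q p (suc n) m)

module Runs {c ℓ : Level} (R : CommutativeRing c ℓ) {X : Set} (_≟X_ : DecidableEquality X) (a : X) where
  open CommutativeRing R hiding (zero)
  open FreeAlg R _≟X_
  open Calculus R _≟X_

  run : ℕ → Word
  run zero    = []
  run (suc n) = a ∷ run n

  prefix : ℕ → Poly → Poly
  prefix zero    p = p
  prefix (suc n) p = a ◁ prefix n p

  prefix-word : ∀ n y → prefix n (word y) ≡ word (run n ++ y)
  prefix-word zero    y = ≡.refl
  prefix-word (suc n) y = ≡.cong (a ◁_) (prefix-word n y)

  prefix-[] : ∀ n → prefix n [] ≡ []
  prefix-[] zero    = ≡.refl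
  prefix-[] (suc n) = ≡.cong (a ◁_) (prefix-[] n)

  prefix-∷ : ∀ n l u p → prefix n ((l , u) ∷ p) ≡ ((l , run n ++ u) ∷ prefix n p)
  prefix-∷ zero    l u p = ≡.refl
  prefix-∷ (suc n) l u p = ≡.cong (a ◁_) (prefix-∷ n l u p)

  prefix-cong : ∀ n {p q} → p ≃ q → prefix n p ≃ prefix n q
  prefix-cong zero    p≃q = p≃q
  prefix-cong (suc n) p≃q = ◁-cong a (prefix-cong n p≃q)

  prefix-· : ∀ n k p → prefix n (k · p) ≡ (k · prefix n p)
  prefix-· zero    k p = ≡.refl
  prefix-· (suc n) k p = ≡.trans (≡.cong (a ◁_) (prefix-· n k p)) (◁-· a k (prefix n p))

  κ : Coef → Coef → ℕ → ℕ → Carrier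
  κ f₁ f₂ = pascal _+_ _*_ 1# (f₁ a a) (f₂ a a)

  -- Conditions under which a-runs move past the first letter of x
  -- (resp. y) unchanged: for x = b…, aᵐ □ bx' starts with aᵐ; for
  -- y = c…, aⁿ □ cy' starts with aⁿ.
  PassesBefore : Coef → Coef → Word → Set ℓ
  PassesBefore f₁ f₂ []      = ⊤
  PassesBefore f₁ f₂ (b ∷ _) = f₁ b a ≈ 0# × f₂ b a ≈ 1#

  PassesAfter : Coef → Coef → Word → Set ℓ
  PassesAfter f₁ f₂ []      = ⊤
  PassesAfter f₁ f₂ (c ∷ _) = f₁ a c ≈ 1# × f₂ a c ≈ 0#

  runs : ∀ f₁ f₂ n m x y → PassesBefore f₁ f₂ x → PassesAfter f₁ f₂ y →
         shw f₁ f₂ (run n ++ x) (run m ++ y) ≃ (κ f₁ f₂ n m · prefix (n ℕ.+ m) (shw f₁ f₂ x y))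
  runs f₁ f₂ zero zero x y _ _ = ≃-sym (·-identity (shw f₁ f₂ x y))
  runs f₁ f₂ zero (suc m) [] y _ _ = begin
    word (run (suc m) ++ y)           ≡⟨ prefix-word (suc m) y ⟨
    prefix (suc m) (word y)           ≈⟨ ·-identity _ ⟨
    1# · prefix (suc m) (word y)      ∎
    where open ≃-Reasoning
  runs f₁ f₂ zero (suc m) (b ∷ x) y (f₁ba≈0 , f₂ba≈1) after = begin
    (f₁ b a · (b ◁ shw f₁ f₂ x (run (suc m) ++ y))) ⊕ (f₂ b a · (a ◁ shw f₁ f₂ (b ∷ x) (run m ++ y)))
      ≈⟨ only-right (b ◁ shw f₁ f₂ x (run (suc m) ++ y)) _ f₁ba≈0 f₂ba≈1 ⟩
    a ◁ shw f₁ f₂ (b ∷ x) (run m ++ y)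
      ≈⟨ ◁-cong a (runs f₁ f₂ zero m (b ∷ x) y (f₁ba≈0 , f₂ba≈1) after) ⟩
    a ◁ (1# · prefix m (shw f₁ f₂ (b ∷ x) y))
      ≡⟨ ◁-· a 1# (prefix m (shw f₁ f₂ (b ∷ x) y)) ⟩
    1# · prefix (suc m) (shw f₁ f₂ (b ∷ x) y)
      ∎
    where open ≃-Reasoning
  runs f₁ f₂ (suc n) zero x [] _ _ = begin
    word (run (suc n) ++ x)                      ≡⟨ prefix-word (suc n) x ⟨
    prefix (suc n) (word x)                      ≡⟨ ≡.cong₂ prefix (≡.sym (ℕP.+-identityʳ (suc n))) (≡.sym (shw-[] x)) ⟩
    prefix (suc n ℕ.+ 0) (shw f₁ f₂ x [])        ≈⟨ ·-identity _ ⟨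
    1# · prefix (suc n ℕ.+ 0) (shw f₁ f₂ x [])   ∎
    where
    open ≃-Reasoning
    shw-[] : ∀ x → shw f₁ f₂ x [] ≡ word x
    shw-[] []      = ≡.refl
    shw-[] (_ ∷ _) = ≡.refl
  runs f₁ f₂ (suc n) zero x (c ∷ y) before (f₁ac≈1 , f₂ac≈0) = begin
    (f₁ a c · (a ◁ shw f₁ f₂ (run n ++ x) (c ∷ y))) ⊕ (f₂ a c · (c ◁ shw f₁ f₂ (run (suc n) ++ x) y))
      ≈⟨ only-left _ (c ◁ shw f₁ f₂ (run (suc n) ++ x) y) f₁ac≈1 f₂ac≈0 ⟩
    a ◁ shw f₁ f₂ (run n ++ x) (c ∷ y)
      ≈⟨ ◁-cong a (runs f₁ f₂ n zero x (c ∷ y) before (f₁ac≈1 , f₂ac≈0)) ⟩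
    a ◁ (κ f₁ f₂ n 0 · prefix (n ℕ.+ 0) S)
      ≡⟨ ◁-· a (κ f₁ f₂ n 0) (prefix (n ℕ.+ 0) S) ⟩
    κ f₁ f₂ n 0 · prefix (suc n ℕ.+ 0) S
      ≡⟨ ≡.cong (_· prefix (suc n ℕ.+ 0) S) (κ-n-0 n) ⟩
    1# · prefix (suc n ℕ.+ 0) S
      ∎
    where
    open ≃-Reasoning
    S : Poly
    S = shw f₁ f₂ x (c ∷ y)
    κ-n-0 : ∀ n → κ f₁ f₂ n 0 ≡ 1#
    κ-n-0 zero    = ≡.refl
    κ-n-0 (suc n) = ≡.refl
  runs f₁ f₂ (suc n) (suc m) x y before after = begin
    (q · (a ◁ shw f₁ f₂ (run n ++ x) (run (suc m) ++ y))) ⊕ (p · (a ◁ shw f₁ f₂ (run (suc n) ++ x) (run m ++ y)))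
      ≈⟨ ⊕-cong (·-congˡ q (◁-cong a (runs f₁ f₂ n (suc m) x y before after)))
                (·-congˡ p (◁-cong a (runs f₁ f₂ (suc n) m x y before after))) ⟩
    (q · (a ◁ (κ₁ · prefix (n ℕ.+ suc m) S))) ⊕ (p · (a ◁ (κ₂ · prefix (suc n ℕ.+ m) S)))
      ≡⟨ ≡.cong₂ (λ s t → (q · s) ⊕ (p · t)) (◁-· a κ₁ (prefix (n ℕ.+ suc m) S)) (◁-· a κ₂ (prefix (suc n ℕ.+ m) S)) ⟩
    (q · (κ₁ · prefix (suc (n ℕ.+ suc m)) S)) ⊕ (p · (κ₂ · prefix (suc (suc n ℕ.+ m)) S))
      ≡⟨ ≡.cong (λ k → (q · (κ₁ · prefix (suc (n ℕ.+ suc m)) S)) ⊕ (p · (κ₂ · prefix (suc k) S))) (≡.sym (ℕP.+-suc n m)) ⟩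
    (q · (κ₁ · T)) ⊕ (p · (κ₂ · T))
      ≈⟨ ⊕-cong (·-assoc q κ₁ T) (·-assoc p κ₂ T) ⟩
    ((q * κ₁) · T) ⊕ ((p * κ₂) · T)
      ≈⟨ ·-distribʳ (q * κ₁) (p * κ₂) T ⟩
    κ f₁ f₂ (suc n) (suc m) · T
      ∎
    where
    open ≃-Reasoning
    q p κ₁ κ₂ : Carrier
    q = f₁ a a; p = f₂ a a
    κ₁ = κ f₁ f₂ n (suc m); κ₂ = κ f₁ f₂ (suc n) m
    S T : Poly
    S = shw f₁ f₂ x y
    T = prefix (suc (n ℕ.+ suc m)) S

  powers : ∀ f₁ f₂ n m → shw f₁ f₂ (run n) (run m) ≃ (κ f₁ f₂ n m · word (run (n ℕ.+ m)))
  powers f₁ f₂ n m = begin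
    shw f₁ f₂ (run n) (run m)                                  ≡⟨ ≡.cong₂ (shw f₁ f₂) (LP.++-identityʳ (run n)) (LP.++-identityʳ (run m)) ⟨
    shw f₁ f₂ (run n ++ []) (run m ++ [])                      ≈⟨ runs f₁ f₂ n m [] [] _ _ ⟩
    κ f₁ f₂ n m · prefix (n ℕ.+ m) (word [])                   ≡⟨ ≡.cong (κ f₁ f₂ n m ·_) (prefix-word (n ℕ.+ m) []) ⟩
    κ f₁ f₂ n m · word (run (n ℕ.+ m) ++ [])                   ≡⟨ ≡.cong (λ w → κ f₁ f₂ n m · word w) (LP.++-identityʳ (run (n ℕ.+ m))) ⟩
    κ f₁ f₂ n m · word (run (n ℕ.+ m))                         ∎
    where open ≃-Reasoning

  coeff-powers : ∀ f₁ f₂ n m → coeff (shw f₁ f₂ (run n) (run m)) (run (n ℕ.+ m)) ≈ κ f₁ f₂ n m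
  coeff-powers f₁ f₂ n m =
    trans (coeff-≈ (powers f₁ f₂ n m) (run (n ℕ.+ m)))
          (trans (coeff-· (κ f₁ f₂ n m) (word W) W) (trans (*-congˡ (trans (coeff-hit 1# W [] W ≡.refl) (+-identityʳ 1#))) (*-identityʳ _)))
    where
    W : Word
    W = run (n ℕ.+ m)

  module PascalLaws (f₁ f₂ : Coef) (isWeakShuffle : IsWeakShuffle f₁ f₂) where
    open WordLaws f₁ f₂ isWeakShuffle
    open import Relation.Binary.Reasoning.Setoid setoid

    κ-comm : ∀ n m → κ f₁ f₂ n m ≈ κ f₁ f₂ m n
    κ-comm n m = begin
      κ f₁ f₂ n m                                                ≈⟨ coeff-powers f₁ f₂ n m ⟨
      coeff (shw f₁ f₂ (run n) (run m)) (run (n ℕ.+ m))          ≈⟨ comm-coeff (run n) (run m) _ ⟩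
      coeff (shw f₁ f₂ (run m) (run n)) (run (n ℕ.+ m))          ≡⟨ ≡.cong (λ k → coeff (shw f₁ f₂ (run m) (run n)) (run k)) (ℕP.+-comm n m) ⟩
      coeff (shw f₁ f₂ (run m) (run n)) (run (m ℕ.+ n))          ≈⟨ coeff-powers f₁ f₂ m n ⟩
      κ f₁ f₂ m n                                                ∎

    κ-assoc : ∀ n m k → κ f₁ f₂ n m * κ f₁ f₂ (n ℕ.+ m) k ≈ κ f₁ f₂ m k * κ f₁ f₂ n (m ℕ.+ k)
    κ-assoc n m k = begin
      κ f₁ f₂ n m * κ f₁ f₂ (n ℕ.+ m) k
        ≈⟨ *-congˡ (coeff-powers f₁ f₂ (n ℕ.+ m) k) ⟨
      κ f₁ f₂ n m * coeff (shw f₁ f₂ (run (n ℕ.+ m)) (run k)) W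
        ≈⟨ eval-·-word (λ s → coeff (shw f₁ f₂ s (run k)) W) (κ f₁ f₂ n m) (run (n ℕ.+ m)) ⟨
      eval (λ s → coeff (shw f₁ f₂ s (run k)) W) (κ f₁ f₂ n m · word (run (n ℕ.+ m)))
        ≈⟨ eval-cong _ (powers f₁ f₂ n m) ⟨
      eval (λ s → coeff (shw f₁ f₂ s (run k)) W) (shw f₁ f₂ (run n) (run m))
        ≈⟨ assoc-coeff (run n) (run m) (run k) W ⟩
      eval (λ s → coeff (shw f₁ f₂ (run n) s) W) (shw f₁ f₂ (run m) (run k))
        ≈⟨ eval-cong _ (powers f₁ f₂ m k) ⟩
      eval (λ s → coeff (shw f₁ f₂ (run n) s) W) (κ f₁ f₂ m k · word (run (m ℕ.+ k)))
        ≈⟨ eval-·-word (λ s → coeff (shw f₁ f₂ (run n) s) W) (κ f₁ f₂ m k) (run (m ℕ.+ k)) ⟩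
      κ f₁ f₂ m k * coeff (shw f₁ f₂ (run n) (run (m ℕ.+ k))) W
        ≡⟨ ≡.cong (λ j → κ f₁ f₂ m k * coeff (shw f₁ f₂ (run n) (run (m ℕ.+ k))) (run j)) (ℕP.+-assoc n m k) ⟩
      κ f₁ f₂ m k * coeff (shw f₁ f₂ (run n) (run (m ℕ.+ k))) (run (n ℕ.+ (m ℕ.+ k)))
        ≈⟨ *-congˡ (coeff-powers f₁ f₂ n (m ℕ.+ k)) ⟩
      κ f₁ f₂ m k * κ f₁ f₂ n (m ℕ.+ k)
        ∎
      where
      W : Word
      W = run (n ℕ.+ m ℕ.+ k)

module DiagonalCoefficients {c ℓ : Level} (R : CommutativeRing c ℓ) (isField : IsField R) (charZero : CharZero R) where
  open CommutativeRing R hiding (zero)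
  open IntegerSolver R using (solve; _:=_; _:+_; _:*_; _:-_; _:^_; num)
  open FieldFacts R isField charZero
  open import Algebra.Properties.Ring ring using (x∙y⁻¹≈ε⇒x≈y; x≈y⇒x∙y⁻¹≈ε; -0#≈0#)
  open import Algebra.Properties.Semiring.Exp semiring using (_^_)
  open import Algebra.Properties.Semiring.Mult.TCOptimised semiring using () renaming (_×_ to _×ₙ_)
  open import Relation.Binary.Reasoning.Setoid setoid

  module _ (q p : Carrier) where

    C : ℕ → ℕ → Carrier
    C = pascal _+_ _*_ 1# q p

    certificate :
      (3 ×ₙ 1#) * (q ^ 2) * (1# - q) * (q + p - 1#)
        ≈ (4 ×ₙ 1#) * (1# - q) * (C 1 1 * C 2 3 - C 1 3 * C 1 4)
          - (1# + (6 ×ₙ 1#) * q - (4 ×ₙ 1#) * q ^ 2 - (4 ×ₙ 1#) * q ^ 3) * (C 1 1 * C 2 2 - C 1 2 * C 1 3)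
          + (p ^ 2 - (3 ×ₙ 1#) * p ^ 3 - (4 ×ₙ 1#) * p ^ 4 - (4 ×ₙ 1#) * p ^ 5
             + q * p + (4 ×ₙ 1#) * q * p ^ 2 - (2 ×ₙ 1#) * q * p ^ 3 - (4 ×ₙ 1#) * q * p ^ 4 + (4 ×ₙ 1#) * q * p ^ 5
             + (7 ×ₙ 1#) * q ^ 2 + (16 ×ₙ 1#) * q ^ 2 * p + (8 ×ₙ 1#) * q ^ 2 * p ^ 4
             - (4 ×ₙ 1#) * q ^ 3 - (12 ×ₙ 1#) * q ^ 3 * p - (8 ×ₙ 1#) * q ^ 3 * p ^ 2 + (4 ×ₙ 1#) * q ^ 3 * p ^ 3
             - (4 ×ₙ 1#) * q ^ 4 - (8 ×ₙ 1#) * q ^ 4 * p)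
            * (C 2 1 - C 1 2)
    certificate = solve 2 (λ q p →
      let c = pascal _:+_ _:*_ (num 1) q p in
      num 3 :* (q :^ 2) :* (num 1 :- q) :* (q :+ p :- num 1)
        := num 4 :* (num 1 :- q) :* (c 1 1 :* c 2 3 :- c 1 3 :* c 1 4)
           :- (num 1 :+ num 6 :* q :- num 4 :* q :^ 2 :- num 4 :* q :^ 3) :* (c 1 1 :* c 2 2 :- c 1 2 :* c 1 3)
           :+ (p :^ 2 :- num 3 :* p :^ 3 :- num 4 :* p :^ 4 :- num 4 :* p :^ 5
               :+ q :* p :+ num 4 :* q :* p :^ 2 :- num 2 :* q :* p :^ 3 :- num 4 :* q :* p :^ 4 :+ num 4 :* q :* p :^ 5
               :+ num 7 :* q :^ 2 :+ num 16 :* q :^ 2 :* p :+ num 8 :* q :^ 2 :* p :^ 4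
               :- num 4 :* q :^ 3 :- num 12 :* q :^ 3 :* p :- num 8 :* q :^ 3 :* p :^ 2 :+ num 4 :* q :^ 3 :* p :^ 3
               :- num 4 :* q :^ 4 :- num 8 :* q :^ 4 :* p)
             :* (c 2 1 :- c 1 2)) refl q p

    q+p≈1 : ¬ q ≈ 0# → ¬ q ≈ 1# →
            C 2 1 ≈ C 1 2 → C 1 1 * C 2 2 ≈ C 1 2 * C 1 3 → C 1 1 * C 2 3 ≈ C 1 3 * C 1 4 →
            q + p ≈ 1#
    q+p≈1 q≉0 q≉1 comm₂₁ assoc₁₁₂ assoc₁₁₃ = x∙y⁻¹≈ε⇒x≈y _ _ (cancel factor≉0 (begin
      (3 ×ₙ 1#) * (q ^ 2) * (1# - q) * (q + p - 1#)   ≈⟨ certificate ⟩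
      _                                             ≈⟨ combination≈0 (x≈y⇒x∙y⁻¹≈ε assoc₁₁₃) (x≈y⇒x∙y⁻¹≈ε assoc₁₁₂) (x≈y⇒x∙y⁻¹≈ε comm₂₁) ⟩
      0#                                            ∎))
      where
      factor≉0 : ¬ (3 ×ₙ 1#) * (q ^ 2) * (1# - q) ≈ 0#
      factor≉0 = *-nonzero (*-nonzero three≉0 (*-nonzero q≉0 (*-nonzero q≉0 1≉0))) 1-q≉0
        where
        1≉0 : ¬ 1# ≈ 0#
        1≉0 1≈0 = IsField.0≉1 isField (sym 1≈0)
        1-q≉0 : ¬ 1# - q ≈ 0#
        1-q≉0 1-q≈0 = q≉1 (sym (x∙y⁻¹≈ε⇒x≈y _ _ 1-q≈0))

      combination≈0 : ∀ {x a y b z d} → a ≈ 0# → b ≈ 0# → d ≈ 0# → x * a - y * b + z * d ≈ 0#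
      combination≈0 {x} {a} {y} {b} {z} {d} a≈0 b≈0 d≈0 = begin
        x * a - y * b + z * d       ≈⟨ +-cong (+-cong (*-congˡ a≈0) (-‿cong (*-congˡ b≈0))) (*-congˡ d≈0) ⟩
        x * 0# - y * 0# + z * 0#    ≈⟨ +-cong (+-cong (zeroʳ x) (trans (-‿cong (zeroʳ y)) -0#≈0#)) (zeroʳ z) ⟩
        0# + 0# + 0#                ≈⟨ trans (+-identityʳ _) (+-identityʳ _) ⟩
        0#                          ∎

module Classification {c ℓ : Level} (R : CommutativeRing c ℓ) (isField : IsField R) (charZero : CharZero R)
                      {X : Set} (_≟X_ : DecidableEquality X)
                      (f₁ f₂ : FreeAlg.Coef R _≟X_) (isWeakShuffle : FreeAlg.IsWeakShuffle R _≟X_ f₁ f₂) where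
  open CommutativeRing R hiding (zero)
  open FreeAlg R _≟X_
  open Calculus R _≟X_
  open WordLaws f₁ f₂ isWeakShuffle
  open IntegerSolver R using (solve; _:=_; _:+_; _:*_; _:-_; :-_; num)
  open FieldFacts R isField charZero
  open import Algebra.Properties.Ring ring using (x∙y⁻¹≈ε⇒x≈y; x≈y⇒x∙y⁻¹≈ε; -0#≈0#)
  open import Relation.Binary.Reasoning.Setoid setoid

  module ShortWords (a b : X) (a≢b : a ≢ b) where
    q p α β γ δ' : Carrier
    q = f₁ a a; p = f₂ a a; α = f₁ a b; β = f₂ a b; γ = f₁ b a; δ' = f₂ b a

    -- the coefficients of aaab in aa □ ab and in a □ aab
    Z Y : Carrier
    Z = p * q * α + p * α * α + q * q
    Y = p * p * α + p * q + q

    record Table : Set ℓ where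
      field
        a□b-ab      : coeff (shw f₁ f₂ (a ∷ []) (b ∷ [])) (a ∷ b ∷ []) ≈ α
        b□a-ab      : coeff (shw f₁ f₂ (b ∷ []) (a ∷ [])) (a ∷ b ∷ []) ≈ δ'
        a□b-ba      : coeff (shw f₁ f₂ (a ∷ []) (b ∷ [])) (b ∷ a ∷ []) ≈ β
        b□a-ba      : coeff (shw f₁ f₂ (b ∷ []) (a ∷ [])) (b ∷ a ∷ []) ≈ γ
        aa□b-aab    : coeff (shw f₁ f₂ (a ∷ a ∷ []) (b ∷ [])) (a ∷ a ∷ b ∷ []) ≈ α * α
        a□ab-aab    : coeff (shw f₁ f₂ (a ∷ []) (a ∷ b ∷ [])) (a ∷ a ∷ b ∷ []) ≈ p * α + q
        a□ba-aab    : coeff (shw f₁ f₂ (a ∷ []) (b ∷ a ∷ [])) (a ∷ a ∷ b ∷ []) ≈ 0#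
        aa□b-aba    : coeff (shw f₁ f₂ (a ∷ a ∷ []) (b ∷ [])) (a ∷ b ∷ a ∷ []) ≈ α * β
        a□ab-aba    : coeff (shw f₁ f₂ (a ∷ []) (a ∷ b ∷ [])) (a ∷ b ∷ a ∷ []) ≈ p * β
        a□ba-aba    : coeff (shw f₁ f₂ (a ∷ []) (b ∷ a ∷ [])) (a ∷ b ∷ a ∷ []) ≈ α
        aa□ab-aaab  : coeff (shw f₁ f₂ (a ∷ a ∷ []) (a ∷ b ∷ [])) (a ∷ a ∷ a ∷ b ∷ []) ≈ Z
        a□aab-aaab  : coeff (shw f₁ f₂ (a ∷ []) (a ∷ a ∷ b ∷ [])) (a ∷ a ∷ a ∷ b ∷ []) ≈ Y
        a□aba-aaab  : coeff (shw f₁ f₂ (a ∷ []) (a ∷ b ∷ a ∷ [])) (a ∷ a ∷ a ∷ b ∷ []) ≈ 0#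

    -- The entries computed from the coefficient recursion, as a product
    -- type (with-abstraction reaches through it, but not into a record).
    Entries : Set ℓ
    Entries =
      (shwCoeff f₁ f₂ (a ∷ []) (b ∷ []) (a ∷ b ∷ []) ≈ α)
      × (shwCoeff f₁ f₂ (b ∷ []) (a ∷ []) (a ∷ b ∷ []) ≈ δ')
      × (shwCoeff f₁ f₂ (a ∷ []) (b ∷ []) (b ∷ a ∷ []) ≈ β)
      × (shwCoeff f₁ f₂ (b ∷ []) (a ∷ []) (b ∷ a ∷ []) ≈ γ)
      × (shwCoeff f₁ f₂ (a ∷ a ∷ []) (b ∷ []) (a ∷ a ∷ b ∷ []) ≈ α * α)
      × (shwCoeff f₁ f₂ (a ∷ []) (a ∷ b ∷ []) (a ∷ a ∷ b ∷ []) ≈ p * α + q)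
      × (shwCoeff f₁ f₂ (a ∷ []) (b ∷ a ∷ []) (a ∷ a ∷ b ∷ []) ≈ 0#)
      × (shwCoeff f₁ f₂ (a ∷ a ∷ []) (b ∷ []) (a ∷ b ∷ a ∷ []) ≈ α * β)
      × (shwCoeff f₁ f₂ (a ∷ []) (a ∷ b ∷ []) (a ∷ b ∷ a ∷ []) ≈ p * β)
      × (shwCoeff f₁ f₂ (a ∷ []) (b ∷ a ∷ []) (a ∷ b ∷ a ∷ []) ≈ α)
      × (shwCoeff f₁ f₂ (a ∷ a ∷ []) (a ∷ b ∷ []) (a ∷ a ∷ a ∷ b ∷ []) ≈ Z)
      × (shwCoeff f₁ f₂ (a ∷ []) (a ∷ a ∷ b ∷ []) (a ∷ a ∷ a ∷ b ∷ []) ≈ Y)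
      × (shwCoeff f₁ f₂ (a ∷ []) (a ∷ b ∷ a ∷ []) (a ∷ a ∷ a ∷ b ∷ []) ≈ 0#)

    -- once a = a, b = b and a ≠ b are decided, every entry is a closed
    -- ring expression and is normalised by the solver
    entries : Entries
    entries with a ≟X a | a ≟X b | b ≟X a | b ≟X b
    ... | yes _ | no _ | no _ | yes _ =
        solve 6 (λ q p α β γ δ → α :* (num 1 :+ num 0) :+ β :* num 0 := α) refl q p α β γ δ'
      , solve 6 (λ q p α β γ δ → γ :* num 0 :+ δ :* (num 1 :+ num 0) := δ) refl q p α β γ δ'
      , solve 6 (λ q p α β γ δ → α :* num 0 :+ β :* (num 1 :+ num 0) := β) refl q p α β γ δ'
      , solve 6 (λ q p α β γ δ → γ :* (num 1 :+ num 0) :+ δ :* num 0 := γ) refl q p α β γ δ'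
      , solve 6 (λ q p α β γ δ → α :* (α :* (num 1 :+ num 0) :+ β :* num 0) :+ β :* num 0 := α :* α) refl q p α β γ δ'
      , solve 6 (λ q p α β γ δ → q :* (num 1 :+ num 0) :+ p :* (α :* (num 1 :+ num 0) :+ β :* num 0) := p :* α :+ q) refl q p α β γ δ'
      , solve 6 (λ q p α β γ δ → α :* (num 0 :+ num 0) :+ β :* num 0 := num 0) refl q p α β γ δ'
      , solve 6 (λ q p α β γ δ → α :* (α :* num 0 :+ β :* (num 1 :+ num 0)) :+ β :* num 0 := α :* β) refl q p α β γ δ'
      , solve 6 (λ q p α β γ δ → q :* (num 0 :+ num 0) :+ p :* (α :* num 0 :+ β :* (num 1 :+ num 0)) := p :* β) refl q p α β γ δ'
      , solve 6 (λ q p α β γ δ → α :* (num 1 :+ num 0) :+ β :* num 0 := α) refl q p α β γ δ'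
      , solve 6 (λ q p α β γ δ →
                       q :* (q :* (num 1 :+ num 0) :+ p :* (α :* (num 1 :+ num 0) :+ β :* num 0))
                         :+ p :* (α :* (α :* (num 1 :+ num 0) :+ β :* num 0) :+ β :* num 0)
                       := p :* q :* α :+ p :* α :* α :+ q :* q) refl q p α β γ δ'
      , solve 6 (λ q p α β γ δ →
                       q :* (num 1 :+ num 0) :+ p :* (q :* (num 1 :+ num 0) :+ p :* (α :* (num 1 :+ num 0) :+ β :* num 0))
                       := p :* p :* α :+ p :* q :+ q) refl q p α β γ δ'
      , solve 6 (λ q p α β γ δ → q :* (num 0 :+ num 0) :+ p :* (α :* (num 0 :+ num 0) :+ β :* num 0) := num 0) refl q p α β γ δ'
    ... | no a≢a | _     | _     | _     = ⊥-elim (a≢a ≡.refl)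
    ... | yes _  | yes e | _     | _     = ⊥-elim (a≢b e)
    ... | yes _  | no _  | yes e | _     = ⊥-elim (a≢b (≡.sym e))
    ... | yes _  | no _  | no _  | no b≢b = ⊥-elim (b≢b ≡.refl)

    table : Table
    table = let (e0 , e1 , e2 , e3 , e4 , e5 , e6 , e7 , e8 , e9 , e10 , e11 , e12) = entries in record
      { a□b-ab = from-shwCoeff (a ∷ []) (b ∷ []) (a ∷ b ∷ []) e0
      ; b□a-ab = from-shwCoeff (b ∷ []) (a ∷ []) (a ∷ b ∷ []) e1
      ; a□b-ba = from-shwCoeff (a ∷ []) (b ∷ []) (b ∷ a ∷ []) e2
      ; b□a-ba = from-shwCoeff (b ∷ []) (a ∷ []) (b ∷ a ∷ []) e3
      ; aa□b-aab = from-shwCoeff (a ∷ a ∷ []) (b ∷ []) (a ∷ a ∷ b ∷ []) e4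
      ; a□ab-aab = from-shwCoeff (a ∷ []) (a ∷ b ∷ []) (a ∷ a ∷ b ∷ []) e5
      ; a□ba-aab = from-shwCoeff (a ∷ []) (b ∷ a ∷ []) (a ∷ a ∷ b ∷ []) e6
      ; aa□b-aba = from-shwCoeff (a ∷ a ∷ []) (b ∷ []) (a ∷ b ∷ a ∷ []) e7
      ; a□ab-aba = from-shwCoeff (a ∷ []) (a ∷ b ∷ []) (a ∷ b ∷ a ∷ []) e8
      ; a□ba-aba = from-shwCoeff (a ∷ []) (b ∷ a ∷ []) (a ∷ b ∷ a ∷ []) e9
      ; aa□ab-aaab = from-shwCoeff (a ∷ a ∷ []) (a ∷ b ∷ []) (a ∷ a ∷ a ∷ b ∷ []) e10
      ; a□aab-aaab = from-shwCoeff (a ∷ []) (a ∷ a ∷ b ∷ []) (a ∷ a ∷ a ∷ b ∷ []) e11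
      ; a□aba-aaab = from-shwCoeff (a ∷ []) (a ∷ b ∷ a ∷ []) (a ∷ a ∷ a ∷ b ∷ []) e12 }
      where
      from-shwCoeff : ∀ u v w {k} → shwCoeff f₁ f₂ u v w ≈ k → coeff (shw f₁ f₂ u v) w ≈ k
      from-shwCoeff u v w = trans (coeff-shw f₁ f₂ u v w)

  -- Ring identities (checked by the solver) turning the associativity
  -- relations at aab, aba and aaab into the equations for α = f₁(a,b).
  -- Each right-hand side is a difference "lhs − rhs" of such a relation,
  -- in the form in which eval produces it.
  aab-identity : ∀ q p α β →
    q * (α * α - α) ≈ ((q * 1#) * (α * α) + ((p * 1#) * (α * α) + 0#)) - ((α * 1#) * (p * α + q) + ((β * 1#) * 0# + 0#))
  aab-identity = solve 4 (λ q p α β →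
    q :* (α :* α :- α) := ((q :* num 1) :* (α :* α) :+ ((p :* num 1) :* (α :* α) :+ num 0)) :- ((α :* num 1) :* (p :* α :+ q) :+ ((β :* num 1) :* num 0 :+ num 0))) refl

  aba-identity : ∀ q p α β →
    p * α * β ≈ α * β * (q + p - 1#) - (((q * 1#) * (α * β) + ((p * 1#) * (α * β) + 0#)) - ((α * 1#) * (p * β) + ((β * 1#) * α + 0#)))
  aba-identity = solve 4 (λ q p α β →
    p :* α :* β := α :* β :* (q :+ p :- num 1) :- (((q :* num 1) :* (α :* β) :+ ((p :* num 1) :* (α :* β) :+ num 0)) :- ((α :* num 1) :* (p :* β) :+ ((β :* num 1) :* α :+ num 0)))) refl

  aaab-identity : ∀ q p α β →
    p * q * q * (α - 1#)
      ≈ (((q * 1#) * (p * q * α + p * α * α + q * q) + ((p * 1#) * (p * q * α + p * α * α + q * q) + 0#))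
          - ((q * 1#) * (p * p * α + p * q + q) + ((p * (α * 1#)) * (p * p * α + p * q + q) + ((p * (β * 1#)) * 0# + 0#))))
        - (p - p * p * p) * (α * α - α)
        - (- (p * α) + p * α * α - p * p * α + q * q) * (q + p - 1#)
  aaab-identity = solve 4 (λ q p α β →
    p :* q :* q :* (α :- num 1)
      := (((q :* num 1) :* (p :* q :* α :+ p :* α :* α :+ q :* q) :+ ((p :* num 1) :* (p :* q :* α :+ p :* α :* α :+ q :* q) :+ num 0))
           :- ((q :* num 1) :* (p :* p :* α :+ p :* q :+ q) :+ ((p :* (α :* num 1)) :* (p :* p :* α :+ p :* q :+ q) :+ ((p :* (β :* num 1)) :* num 0 :+ num 0))))
         :- (p :- p :* p :* p) :* (α :* α :- α)
         :- (:- (p :* α) :+ p :* α :* α :- p :* p :* α :+ q :* q) :* (q :+ p :- num 1)) refl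

  module LetterOfT (a : X) (a∈T : InT f₁ a) where
    open Runs R _≟X_ a using (module PascalLaws)
    open PascalLaws f₁ f₂ isWeakShuffle

    q≉0 : ¬ f₁ a a ≈ 0#
    q≉0 = proj₁ a∈T

    q≉1 : ¬ f₁ a a ≈ 1#
    q≉1 = proj₂ a∈T

    q+p≈1 : f₁ a a + f₂ a a ≈ 1#
    q+p≈1 = DiagonalCoefficients.q+p≈1 R isField charZero (f₁ a a) (f₂ a a) q≉0 q≉1
              (κ-comm 2 1) (κ-assoc 1 1 2) (κ-assoc 1 1 3)

    p≉0 : ¬ f₂ a a ≈ 0#
    p≉0 p≈0 = q≉1 (trans (sym (trans (+-congˡ p≈0) (+-identityʳ _))) q+p≈1)

    module Mixed (b : X) (b≢a : b ≢ a) where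
      open ShortWords a b (λ a≡b → b≢a (≡.sym a≡b))
      open Table table

      q+p-1≈0 : q + p - 1# ≈ 0#
      q+p-1≈0 = x≈y⇒x∙y⁻¹≈ε q+p≈1

      assoc-aab : (q * 1#) * (α * α) + ((p * 1#) * (α * α) + 0#) ≈ (α * 1#) * (p * α + q) + ((β * 1#) * 0# + 0#)
      assoc-aab = begin
        (q * 1#) * (α * α) + ((p * 1#) * (α * α) + 0#)  ≈⟨ +-cong (*-congˡ aa□b-aab) (+-congʳ (*-congˡ aa□b-aab)) ⟨
        eval (λ s → coeff (shw f₁ f₂ s (b ∷ [])) aab) (shw f₁ f₂ (a ∷ []) (a ∷ []))  ≈⟨ assoc-coeff (a ∷ []) (a ∷ []) (b ∷ []) aab ⟩
        eval (λ s → coeff (shw f₁ f₂ (a ∷ []) s) aab) (shw f₁ f₂ (a ∷ []) (b ∷ []))  ≈⟨ +-cong (*-congˡ a□ab-aab) (+-congʳ (*-congˡ a□ba-aab)) ⟩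
        (α * 1#) * (p * α + q) + ((β * 1#) * 0# + 0#)  ∎
        where
        aab : Word
        aab = a ∷ a ∷ b ∷ []

      assoc-aba : (q * 1#) * (α * β) + ((p * 1#) * (α * β) + 0#) ≈ (α * 1#) * (p * β) + ((β * 1#) * α + 0#)
      assoc-aba = begin
        (q * 1#) * (α * β) + ((p * 1#) * (α * β) + 0#)  ≈⟨ +-cong (*-congˡ aa□b-aba) (+-congʳ (*-congˡ aa□b-aba)) ⟨
        eval (λ s → coeff (shw f₁ f₂ s (b ∷ [])) aba) (shw f₁ f₂ (a ∷ []) (a ∷ []))  ≈⟨ assoc-coeff (a ∷ []) (a ∷ []) (b ∷ []) aba ⟩
        eval (λ s → coeff (shw f₁ f₂ (a ∷ []) s) aba) (shw f₁ f₂ (a ∷ []) (b ∷ []))  ≈⟨ +-cong (*-congˡ a□ab-aba) (+-congʳ (*-congˡ a□ba-aba)) ⟩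
        (α * 1#) * (p * β) + ((β * 1#) * α + 0#)  ∎
        where
        aba : Word
        aba = a ∷ b ∷ a ∷ []

      assoc-aaab : (q * 1#) * Z + ((p * 1#) * Z + 0#) ≈ (q * 1#) * Y + ((p * (α * 1#)) * Y + ((p * (β * 1#)) * 0# + 0#))
      assoc-aaab = begin
        (q * 1#) * Z + ((p * 1#) * Z + 0#)  ≈⟨ +-cong (*-congˡ aa□ab-aaab) (+-congʳ (*-congˡ aa□ab-aaab)) ⟨
        eval (λ s → coeff (shw f₁ f₂ s (a ∷ b ∷ [])) aaab) (shw f₁ f₂ (a ∷ []) (a ∷ []))  ≈⟨ assoc-coeff (a ∷ []) (a ∷ []) (a ∷ b ∷ []) aaab ⟩
        eval (λ s → coeff (shw f₁ f₂ (a ∷ []) s) aaab) (shw f₁ f₂ (a ∷ []) (a ∷ b ∷ []))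
          ≈⟨ +-cong (*-congˡ a□aab-aaab) (+-cong (*-congˡ a□aab-aaab) (+-congʳ (*-congˡ a□aba-aaab))) ⟩
        (q * 1#) * Y + ((p * (α * 1#)) * Y + ((p * (β * 1#)) * 0# + 0#))  ∎
        where
        aaab : Word
        aaab = a ∷ a ∷ a ∷ b ∷ []

      α²≈α : α * α - α ≈ 0#
      α²≈α = cancel q≉0 (trans (aab-identity q p α β) (x≈y⇒x∙y⁻¹≈ε assoc-aab))

      f₁ab≈1 : f₁ a b ≈ 1#
      f₁ab≈1 = x∙y⁻¹≈ε⇒x≈y _ _ (cancel (*-nonzero (*-nonzero p≉0 q≉0) q≉0) (begin
        p * q * q * (α - 1#)   ≈⟨ aaab-identity q p α β ⟩
        _                      ≈⟨ vanishing (x≈y⇒x∙y⁻¹≈ε assoc-aaab) α²≈α q+p-1≈0 ⟩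
        0#                     ∎))
        where
        vanishing : ∀ {x y z u v} → x ≈ 0# → y ≈ 0# → z ≈ 0# → x - u * y - v * z ≈ 0#
        vanishing {x} {y} {z} {u} {v} x≈0 y≈0 z≈0 = begin
          x - u * y - v * z     ≈⟨ +-cong (+-cong x≈0 (-‿cong (*-congˡ y≈0))) (-‿cong (*-congˡ z≈0)) ⟩
          0# - u * 0# - v * 0#  ≈⟨ +-cong (+-congˡ (-‿cong (zeroʳ u))) (-‿cong (zeroʳ v)) ⟩
          0# - 0# - 0#          ≈⟨ +-cong (trans (+-congˡ -0#≈0#) (+-identityʳ _)) -0#≈0# ⟩
          0# + 0#               ≈⟨ +-identityʳ _ ⟩
          0#                    ∎

      f₂ab≈0 : f₂ a b ≈ 0#
      f₂ab≈0 = begin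
        β         ≈⟨ *-identityˡ β ⟨
        1# * β    ≈⟨ *-congʳ f₁ab≈1 ⟨
        α * β     ≈⟨ cancel p≉0 (trans (sym (*-assoc _ _ _)) (trans (aba-identity q p α β) vanishing)) ⟩
        0#        ∎
        where
        vanishing : α * β * (q + p - 1#) - (_ - _) ≈ 0#
        vanishing = begin
          α * β * (q + p - 1#) - (_ - _)  ≈⟨ +-cong (trans (*-congˡ q+p-1≈0) (zeroʳ _)) (-‿cong (x≈y⇒x∙y⁻¹≈ε assoc-aba)) ⟩
          0# - 0#                         ≈⟨ trans (+-identityˡ _) -0#≈0# ⟩
          0#                              ∎

      f₁ba≈0 : f₁ b a ≈ 0#
      f₁ba≈0 = trans (sym β≈γ) f₂ab≈0
        where
        β≈γ : β ≈ γ
        β≈γ = trans (sym a□b-ba) (trans (comm-coeff (a ∷ []) (b ∷ []) (b ∷ a ∷ [])) b□a-ba)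

      f₂ba≈1 : f₂ b a ≈ 1#
      f₂ba≈1 = trans (sym α≈δ) f₁ab≈1
        where
        α≈δ : α ≈ δ'
        α≈δ = trans (sym a□b-ab) (trans (comm-coeff (a ∷ []) (b ∷ []) (a ∷ b ∷ [])) b□a-ab)

  -- T has at most one element: for distinct a, b ∈ T the coefficient
  -- f₁(b,a) would be 0 (seen from a) and 1 (seen from b).
  T-subsingleton : ∀ a → InT f₁ a → ∀ b → InT f₁ b → b ≡ a
  T-subsingleton a a∈T b b∈T with b ≟X a
  ... | yes b≡a = b≡a
  ... | no  b≢a = ⊥-elim (IsField.0≉1 isField (begin
      0#        ≈⟨ LetterOfT.Mixed.f₁ba≈0 a a∈T b b≢a ⟨
      f₁ b a    ≈⟨ LetterOfT.Mixed.f₁ab≈1 b b∈T a (λ a≡b → b≢a (≡.sym a≡b)) ⟩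
      1#        ∎))

module DiagonalRescaling {c ℓ : Level} (R : CommutativeRing c ℓ) (isField : IsField R)
                         {X : Set} (_≟X_ : DecidableEquality X) where
  open CommutativeRing R
  open FreeAlg R _≟X_
  open Calculus R _≟X_
  open import Relation.Binary.Reasoning.Setoid setoid

  scale : (Word → Carrier) → Poly → Poly
  scale ω = List.map λ { (k , u) → (k * ω u , u) }

  coeff-scale : ∀ ω p w → coeff (scale ω p) w ≈ ω w * coeff p w
  coeff-scale ω []            w = sym (zeroʳ _)
  coeff-scale ω ((k , u) ∷ p) w = case u ≟W w of λ
    { (yes ≡.refl) → begin
        coeff ((k * ω u , u) ∷ scale ω p) u   ≈⟨ coeff-hit (k * ω u) u (scale ω p) u ≡.refl ⟩
        k * ω u + coeff (scale ω p) u        ≈⟨ +-cong (*-comm _ _) (coeff-scale ω p u) ⟩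
        ω u * k + ω u * coeff p u            ≈⟨ distribˡ _ _ _ ⟨
        ω u * (k + coeff p u)                ≈⟨ *-congˡ (coeff-hit k u p u ≡.refl) ⟨
        ω u * coeff ((k , u) ∷ p) u          ∎
    ; (no u≢w) → begin
        coeff ((k * ω u , u) ∷ scale ω p) w   ≈⟨ coeff-miss (k * ω u) u (scale ω p) w u≢w ⟩
        coeff (scale ω p) w                  ≈⟨ coeff-scale ω p w ⟩
        ω w * coeff p w                      ≈⟨ *-congˡ (coeff-miss k u p w u≢w) ⟨
        ω w * coeff ((k , u) ∷ p) w          ∎ }

  scale-cong : ∀ ω {p q} → p ≃ q → scale ω p ≃ scale ω q
  scale-cong ω {p} {q} p≃q = by-coeff λ w →
    trans (coeff-scale ω p w) (trans (*-congˡ (coeff-≈ p≃q w)) (sym (coeff-scale ω q w)))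

  scale-· : ∀ ω k p → scale ω (k · p) ≃ (k · scale ω p)
  scale-· ω k p = by-coeff λ w → begin
    coeff (scale ω (k · p)) w    ≈⟨ coeff-scale ω (k · p) w ⟩
    ω w * coeff (k · p) w        ≈⟨ *-congˡ (coeff-· k p w) ⟩
    ω w * (k * coeff p w)        ≈⟨ x*[y*z]≈y*[x*z] _ _ _ ⟩
    k * (ω w * coeff p w)        ≈⟨ *-congˡ (coeff-scale ω p w) ⟨
    k * coeff (scale ω p) w      ≈⟨ coeff-· k (scale ω p) w ⟨
    coeff (k · scale ω p) w      ∎
    where
    x*[y*z]≈y*[x*z] : ∀ x y z → x * (y * z) ≈ y * (x * z)
    x*[y*z]≈y*[x*z] x y z = trans (sym (*-assoc _ _ _)) (trans (*-congʳ (*-comm x y)) (*-assoc _ _ _))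

  scale-⊕ : ∀ ω p q → scale ω (p ⊕ q) ≡ (scale ω p ⊕ scale ω q)
  scale-⊕ ω p q = LP.map-++ _ p q

  eval-scale : ∀ ω h p → eval h (scale ω p) ≈ eval (λ u → ω u * h u) p
  eval-scale ω h []            = refl
  eval-scale ω h ((k , u) ∷ p) = +-cong (*-assoc _ _ _) (eval-scale ω h p)

  module _ (ω : Word → Carrier) (ω≉0 : ∀ w → ¬ ω w ≈ 0#) (ω-unit : ω [] ≈ 1#)
           (F G F' G' : Coef)
           (scale-shw : ∀ u v → scale ω (shw F G u v) ≃ ((ω u * ω v) · shw F' G' u v)) where

    ω⁻¹ : Word → Carrier
    ω⁻¹ w = proj₁ (IsField.inverse isField (ω w) (ω≉0 w))

    ωω⁻¹≈1 : ∀ w → ω w * ω⁻¹ w ≈ 1#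
    ωω⁻¹≈1 w = proj₂ (IsField.inverse isField (ω w) (ω≉0 w))

    scale-inverse : ∀ p → scale ω (scale ω⁻¹ p) ≃ p
    scale-inverse p = by-coeff λ w → begin
      coeff (scale ω (scale ω⁻¹ p)) w    ≈⟨ coeff-scale ω (scale ω⁻¹ p) w ⟩
      ω w * coeff (scale ω⁻¹ p) w        ≈⟨ *-congˡ (coeff-scale ω⁻¹ p w) ⟩
      ω w * (ω⁻¹ w * coeff p w)          ≈⟨ *-assoc _ _ _ ⟨
      (ω w * ω⁻¹ w) * coeff p w          ≈⟨ *-congʳ (ωω⁻¹≈1 w) ⟩
      1# * coeff p w                     ≈⟨ *-identityˡ _ ⟩
      coeff p w                          ∎

    inverse-scale : ∀ p → scale ω⁻¹ (scale ω p) ≃ p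
    inverse-scale p = by-coeff λ w → begin
      coeff (scale ω⁻¹ (scale ω p)) w    ≈⟨ coeff-scale ω⁻¹ (scale ω p) w ⟩
      ω⁻¹ w * coeff (scale ω p) w        ≈⟨ *-congˡ (coeff-scale ω p w) ⟩
      ω⁻¹ w * (ω w * coeff p w)          ≈⟨ *-assoc _ _ _ ⟨
      (ω⁻¹ w * ω w) * coeff p w          ≈⟨ *-congʳ (trans (*-comm _ _) (ωω⁻¹≈1 w)) ⟩
      1# * coeff p w                     ≈⟨ *-identityˡ _ ⟩
      coeff p w                          ∎

    -- multiplicativity on words extends bilinearly
    scale-sh : ∀ p q → scale ω (sh F G p q) ≃ sh F' G' (scale ω p) (scale ω q)
    scale-sh p q = by-coeff λ w → begin
      coeff (scale ω (sh F G p q)) w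
        ≈⟨ coeff-scale ω (sh F G p q) w ⟩
      ω w * coeff (sh F G p q) w
        ≈⟨ *-congˡ (sh-coeff F G p q w) ⟩
      ω w * eval (λ u → eval (λ v → coeff (shw F G u v) w) q) p
        ≈⟨ eval-scaleʰ (ω w) _ p ⟨
      eval (λ u → ω w * eval (λ v → coeff (shw F G u v) w) q) p
        ≈⟨ eval-congʰ p (λ u → sym (eval-scaleʰ (ω w) _ q)) ⟩
      eval (λ u → eval (λ v → ω w * coeff (shw F G u v) w) q) p
        ≈⟨ eval-congʰ p (λ u → eval-congʰ q (λ v → on-words u v w)) ⟩
      eval (λ u → eval (λ v → ω u * (ω v * coeff (shw F' G' u v) w)) q) p
        ≈⟨ eval-congʰ p (λ u → eval-scaleʰ (ω u) _ q) ⟩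
      eval (λ u → ω u * eval (λ v → ω v * coeff (shw F' G' u v) w) q) p
        ≈⟨ eval-congʰ p (λ u → *-congˡ (eval-scale ω _ q)) ⟨
      eval (λ u → ω u * eval (λ v → coeff (shw F' G' u v) w) (scale ω q)) p
        ≈⟨ eval-scale ω _ p ⟨
      eval (λ u → eval (λ v → coeff (shw F' G' u v) w) (scale ω q)) (scale ω p)
        ≈⟨ sh-coeff F' G' (scale ω p) (scale ω q) w ⟨
      coeff (sh F' G' (scale ω p) (scale ω q)) w
        ∎
      where
      on-words : ∀ u v w → ω w * coeff (shw F G u v) w ≈ ω u * (ω v * coeff (shw F' G' u v) w)
      on-words u v w = begin
        ω w * coeff (shw F G u v) w                  ≈⟨ coeff-scale ω (shw F G u v) w ⟨
        coeff (scale ω (shw F G u v)) w              ≈⟨ coeff-≈ (scale-shw u v) w ⟩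
        coeff ((ω u * ω v) · shw F' G' u v) w        ≈⟨ coeff-· (ω u * ω v) (shw F' G' u v) w ⟩
        (ω u * ω v) * coeff (shw F' G' u v) w        ≈⟨ *-assoc _ _ _ ⟩
        ω u * (ω v * coeff (shw F' G' u v) w)        ∎

    rescaling-iso : AlgIso F G F' G'
    rescaling-iso = record
      { to        = scale ω
      ; from      = scale ω⁻¹
      ; to-cong   = λ p q p≋q → coeff-≈ (scale-cong ω {p} {q} (by-coeff p≋q))
      ; from-cong = λ p q p≋q → coeff-≈ (scale-cong ω⁻¹ {p} {q} (by-coeff p≋q))
      ; to-from   = λ p → coeff-≈ (scale-inverse p)
      ; from-to   = λ p → coeff-≈ (inverse-scale p)
      ; to-+      = λ p q → coeff-≈ (≡⇒≃ (scale-⊕ ω p q))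
      ; to-·      = λ k p → coeff-≈ (scale-· ω k p)
      ; to-mul    = λ p q → coeff-≈ (scale-sh p q)
      ; to-one    = coeff-≈ (∷-cong [] {[]} (trans (*-congˡ ω-unit) (*-identityʳ 1#)) ≃-refl)
      }

    transport : IsWeakShuffle F G → IsWeakShuffle F' G'
    transport isWeakShuffle = record { assoc = assoc' ; comm = comm' }
      where
      open IsWeakShuffle isWeakShuffle
      □ □' : Poly → Poly → Poly
      □  = sh F G
      □' = sh F' G'
      pull : ∀ x → x ≃ scale ω (scale ω⁻¹ x)
      pull x = ≃-sym (scale-inverse x)

      comm' : ∀ x y → □' x y ≋ □' y x
      comm' x y w = begin
        coeff (□' x y) w                                      ≈⟨ coeff-≈ (sh-cong F' G' (pull x) (pull y)) w ⟩
        coeff (□' (scale ω x⁻) (scale ω y⁻)) w                ≈⟨ coeff-≈ (scale-sh x⁻ y⁻) w ⟨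
        coeff (scale ω (□ x⁻ y⁻)) w                           ≈⟨ coeff-≈ (scale-cong ω {□ x⁻ y⁻} {□ y⁻ x⁻} (by-coeff (comm x⁻ y⁻))) w ⟩
        coeff (scale ω (□ y⁻ x⁻)) w                           ≈⟨ coeff-≈ (scale-sh y⁻ x⁻) w ⟩
        coeff (□' (scale ω y⁻) (scale ω x⁻)) w                ≈⟨ coeff-≈ (sh-cong F' G' (pull y) (pull x)) w ⟨
        coeff (□' y x) w                                      ∎
        where
        x⁻ y⁻ : Poly
        x⁻ = scale ω⁻¹ x; y⁻ = scale ω⁻¹ y

      assoc' : ∀ x y z → □' (□' x y) z ≋ □' x (□' y z)
      assoc' x y z w = begin
        coeff (□' (□' x y) z) w
          ≈⟨ coeff-≈ (sh-cong F' G' (≃-trans (sh-cong F' G' (pull x) (pull y)) (≃-sym (scale-sh x⁻ y⁻))) (pull z)) w ⟩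
        coeff (□' (scale ω (□ x⁻ y⁻)) (scale ω z⁻)) w
          ≈⟨ coeff-≈ (scale-sh (□ x⁻ y⁻) z⁻) w ⟨
        coeff (scale ω (□ (□ x⁻ y⁻) z⁻)) w
          ≈⟨ coeff-≈ (scale-cong ω {□ (□ x⁻ y⁻) z⁻} {□ x⁻ (□ y⁻ z⁻)} (by-coeff (assoc x⁻ y⁻ z⁻))) w ⟩
        coeff (scale ω (□ x⁻ (□ y⁻ z⁻))) w
          ≈⟨ coeff-≈ (scale-sh x⁻ (□ y⁻ z⁻)) w ⟩
        coeff (□' (scale ω x⁻) (scale ω (□ y⁻ z⁻))) w
          ≈⟨ coeff-≈ (sh-cong F' G' (pull x) (≃-trans (sh-cong F' G' (pull y) (pull z)) (≃-sym (scale-sh y⁻ z⁻)))) w ⟨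
        coeff (□' x (□' y z)) w
          ∎
        where
        x⁻ y⁻ z⁻ : Poly
        x⁻ = scale ω⁻¹ x; y⁻ = scale ω⁻¹ y; z⁻ = scale ω⁻¹ z

-- The weights for a letter a: ω(w) is the product of n! over the maximal
-- runs aⁿ in w.  This rescaling turns □ into the product □' in which
-- f₁(a,a) = f₂(a,a) = 1 (runs of a then shuffle with binomial
-- coefficients), provided a commutes with the other letters as in the
-- shuffle product.
module RunWeights {c ℓ : Level} (R : CommutativeRing c ℓ) (isField : IsField R) (charZero : CharZero R)
                  {X : Set} (_≟X_ : DecidableEquality X) (a : X) where
  open CommutativeRing R hiding (zero)
  open FreeAlg R _≟X_
  open Calculus R _≟X_
  open Runs R _≟X_ a
  open DiagonalRescaling R isField _≟X_ using (scale; coeff-scale; scale-cong; scale-·; scale-⊕)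
  open FieldFacts R isField charZero using (*-nonzero)
  module ≈-Reasoning = Relation.Binary.Reasoning.Setoid setoid

  infix 30 _!
  _! : ℕ → Carrier
  zero  ! = 1#
  suc n ! = ofℕ R (suc n) * n !

  !≉0 : ∀ n → ¬ n ! ≈ 0#
  !≉0 zero    = λ 1≈0 → IsField.0≉1 isField (sym 1≈0)
  !≉0 (suc n) = *-nonzero (charZero n) (!≉0 n)

  -- pending k w is the weight of aᵏw
  pending : ℕ → Word → Carrier
  pending k []      = k !
  pending k (x ∷ w) = if does (x ≟X a) then pending (suc k) w else k ! * pending 0 w

  ω : Word → Carrier
  ω = pending 0

  pending≉0 : ∀ k w → ¬ pending k w ≈ 0#
  pending≉0 k []      = !≉0 k
  pending≉0 k (x ∷ w) with does (x ≟X a)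
  ... | true  = pending≉0 (suc k) w
  ... | false = *-nonzero (!≉0 k) (pending≉0 0 w)

  ω≉0 : ∀ w → ¬ ω w ≈ 0#
  ω≉0 = pending≉0 0

  NoLeadingA : Word → Set
  NoLeadingA []      = ⊤
  NoLeadingA (b ∷ _) = b ≢ a

  pending-a : ∀ k w → pending k (a ∷ w) ≡ pending (suc k) w
  pending-a k w rewrite dec-true (a ≟X a) ≡.refl = ≡.refl

  pending-other : ∀ k b w → b ≢ a → pending k (b ∷ w) ≡ k ! * ω w
  pending-other k b w b≢a rewrite dec-false (b ≟X a) b≢a = ≡.refl

  pending-run : ∀ k n x → pending k (run n ++ x) ≡ pending (k ℕ.+ n) x
  pending-run k zero    x = ≡.cong (λ j → pending j x) (≡.sym (ℕP.+-identityʳ k))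
  pending-run k (suc n) x = ≡.trans (pending-a k (run n ++ x))
                              (≡.trans (pending-run (suc k) n x) (≡.cong (λ j → pending j x) (≡.sym (ℕP.+-suc k n))))

  pending-NoLeadingA : ∀ k x → NoLeadingA x → pending k x ≈ k ! * ω x
  pending-NoLeadingA k []      _   = sym (*-identityʳ _)
  pending-NoLeadingA k (b ∷ x) b≢a = begin
    pending k (b ∷ x)     ≡⟨ pending-other k b x b≢a ⟩
    k ! * ω x             ≈⟨ *-congˡ (*-identityˡ _) ⟨
    k ! * (1# * ω x)      ≡⟨ ≡.cong (k ! *_) (pending-other 0 b x b≢a) ⟨
    k ! * ω (b ∷ x)       ∎
    where open ≈-Reasoning

  ω-run : ∀ n x → NoLeadingA x → ω (run n ++ x) ≈ n ! * ω x
  ω-run n x x∌a = ≡.subst (_≈ n ! * ω x) (≡.sym (pending-run 0 n x)) (pending-NoLeadingA n x x∌a)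

  ω-other : ∀ b x → b ≢ a → ω (b ∷ x) ≈ ω x
  ω-other b x b≢a = ≡.subst (_≈ ω x) (≡.sym (pending-other 0 b x b≢a)) (*-identityˡ _)

  Supported : Poly → Set c
  Supported = All (λ { (_ , u) → NoLeadingA u })

  ◁-supported : ∀ b p → b ≢ a → Supported (b ◁ p)
  ◁-supported b []            b≢a = []
  ◁-supported b ((l , u) ∷ p) b≢a = b≢a ∷ ◁-supported b p b≢a

  ·-supported : ∀ k p → Supported p → Supported (k · p)
  ·-supported k []            []           = []
  ·-supported k ((l , u) ∷ p) (u∌a ∷ p∌a) = u∌a ∷ ·-supported k p p∌a

  ⊕-supported : ∀ p q → Supported p → Supported q → Supported (p ⊕ q)
  ⊕-supported []            q []           q∌a = q∌a
  ⊕-supported ((l , u) ∷ p) q (u∌a ∷ p∌a) q∌a = u∌a ∷ ⊕-supported p q p∌a q∌a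

  shw-supported : ∀ F G x y → NoLeadingA x → NoLeadingA y → Supported (shw F G x y)
  shw-supported F G []      y       _   y∌a = y∌a ∷ []
  shw-supported F G (b ∷ x) []      b≢a _   = b≢a ∷ []
  shw-supported F G (b ∷ x) (c ∷ y) b≢a c≢a =
    ⊕-supported (F b c · (b ◁ shw F G x (c ∷ y))) (G b c · (c ◁ shw F G (b ∷ x) y))
      (·-supported (F b c) _ (◁-supported b _ b≢a)) (·-supported (G b c) _ (◁-supported c _ c≢a))

  scale-prefix : ∀ k p → Supported p → scale ω (prefix k p) ≃ (k ! · prefix k (scale ω p))
  scale-prefix k []            []           rewrite prefix-[] k = ≃-refl
  scale-prefix k ((l , u) ∷ p) (u∌a ∷ p∌a) rewrite prefix-∷ k l u p | prefix-∷ k (l * ω u) u (scale ω p) =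
    ∷-cong (run k ++ u) weight-step (scale-prefix k p p∌a)
    where
    weight-step : l * ω (run k ++ u) ≈ k ! * (l * ω u)
    weight-step = begin
      l * ω (run k ++ u)   ≈⟨ *-congˡ (ω-run k u u∌a) ⟩
      l * (k ! * ω u)      ≈⟨ *-assoc _ _ _ ⟨
      (l * k !) * ω u      ≈⟨ *-congʳ (*-comm _ _) ⟩
      (k ! * l) * ω u      ≈⟨ *-assoc _ _ _ ⟩
      k ! * (l * ω u)      ∎
      where open ≈-Reasoning

  scale-◁ : ∀ b p → b ≢ a → scale ω (b ◁ p) ≃ (b ◁ scale ω p)
  scale-◁ b []            b≢a = ≃-refl
  scale-◁ b ((l , u) ∷ p) b≢a = ∷-cong (b ∷ u) (*-congˡ (ω-other b u b≢a)) (scale-◁ b p b≢a)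

  record Decomposition (u : Word) : Set where
    constructor decomposition
    field
      n      : ℕ
      x      : Word
      u≡aⁿx  : u ≡ run n ++ x
      x∌a    : NoLeadingA x

  decompose : ∀ u → Decomposition u
  decompose []      = decomposition 0 [] ≡.refl _
  decompose (y ∷ u) with y ≟X a | decompose u
  ... | yes ≡.refl | decomposition n x u≡aⁿx x∌a = decomposition (suc n) x (≡.cong (a ∷_) u≡aⁿx) x∌a
  ... | no  y≢a    | _                           = decomposition 0 (y ∷ u) ≡.refl y≢a

  merge-weights : ∀ n m x y κ' → NoLeadingA x → NoLeadingA y → n ! * m ! * κ' ≈ (n ℕ.+ m) ! →
                  (n ℕ.+ m) ! * (ω x * ω y) ≈ (ω (run n ++ x) * ω (run m ++ y)) * κ'
  merge-weights n m x y κ' x∌a y∌a binomial = begin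
    (n ℕ.+ m) ! * (ω x * ω y)                    ≈⟨ *-congʳ binomial ⟨
    (n ! * m ! * κ') * (ω x * ω y)               ≈⟨ rearrange (n !) (m !) κ' (ω x) (ω y) ⟩
    ((n ! * ω x) * (m ! * ω y)) * κ'             ≈⟨ *-congʳ (*-cong (ω-run n x x∌a) (ω-run m y y∌a)) ⟨
    (ω (run n ++ x) * ω (run m ++ y)) * κ'       ∎
    where
    open ≈-Reasoning
    rearrange : ∀ A B K x y → (A * B * K) * (x * y) ≈ ((A * x) * (B * y)) * K
    rearrange = IntegerSolver.solve R 5 (λ A B K x y → (A :* B :* K) :* (x :* y) := ((A :* x) :* (B :* y)) :* K) refl
      where open IntegerSolver R using (_:*_; _:=_)

  record ShufflesWithOthers (F G : Coef) : Set ℓ where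
    field
      before : ∀ b → b ≢ a → F b a ≈ 0# × G b a ≈ 1#
      after  : ∀ c → c ≢ a → F a c ≈ 1# × G a c ≈ 0#

    passesBefore : ∀ x → NoLeadingA x → PassesBefore F G x
    passesBefore []      _   = _
    passesBefore (b ∷ x) b≢a = before b b≢a

    passesAfter : ∀ y → NoLeadingA y → PassesAfter F G y
    passesAfter []      _   = _
    passesAfter (c ∷ y) c≢a = after c c≢a

  module Multiplicativity (F G F' G' : Coef) (mixes : ShufflesWithOthers F G) (mixes' : ShufflesWithOthers F' G')
      (κ≈1 : ∀ n m → κ F G n m ≈ 1#) (κ'-binomial : ∀ n m → n ! * m ! * κ F' G' n m ≈ (n ℕ.+ m) !)
      (agree₁ : ∀ b c → b ≢ a → c ≢ a → F b c ≈ F' b c) (agree₂ : ∀ b c → b ≢ a → c ≢ a → G b c ≈ G' b c) where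
    open ShufflesWithOthers
    open ≃-Reasoning

    mutual
      scale-shw-bounded : ∀ N u v → length u ℕ.+ length v ℕ.≤ N →
                          scale ω (shw F G u v) ≃ ((ω u * ω v) · shw F' G' u v)
      scale-shw-bounded N u v bound with decompose u | decompose v
      ... | decomposition n x ≡.refl x∌a | decomposition m y ≡.refl y∌a = begin
        scale ω (shw F G (run n ++ x) (run m ++ y))
          ≈⟨ scale-cong ω (runs F G n m x y (passesBefore mixes x x∌a) (passesAfter mixes y y∌a)) ⟩
        scale ω (κ F G n m · prefix k S)
          ≈⟨ scale-· ω (κ F G n m) (prefix k S) ⟩
        κ F G n m · scale ω (prefix k S)
          ≈⟨ ·-cong (κ≈1 n m) (scale-prefix k S (shw-supported F G x y x∌a y∌a)) ⟩
        1# · (k ! · prefix k (scale ω S))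
          ≈⟨ ·-identity _ ⟩
        k ! · prefix k (scale ω S)
          ≈⟨ ·-congˡ (k !) (prefix-cong k (scale-shw-initial N x y x∌a y∌a bound′)) ⟩
        k ! · prefix k ((ω x * ω y) · S')
          ≡⟨ ≡.cong (k ! ·_) (prefix-· k (ω x * ω y) S') ⟩
        k ! · ((ω x * ω y) · prefix k S')
          ≈⟨ ·-exchange (prefix k S') (merge-weights n m x y (κ F' G' n m) x∌a y∌a (κ'-binomial n m)) ⟩
        (ω (run n ++ x) * ω (run m ++ y)) · (κ F' G' n m · prefix k S')
          ≈⟨ ·-congˡ _ (runs F' G' n m x y (passesBefore mixes' x x∌a) (passesAfter mixes' y y∌a)) ⟨
        (ω (run n ++ x) * ω (run m ++ y)) · shw F' G' (run n ++ x) (run m ++ y)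
          ∎
        where
        k : ℕ
        k = n ℕ.+ m
        S S' : Poly
        S = shw F G x y
        S' = shw F' G' x y
        bound′ : length x ℕ.+ length y ℕ.≤ N
        bound′ = ℕP.≤-trans (ℕP.+-mono-≤ (length-run n x) (length-run m y)) bound
          where
          length-run : ∀ n x → length x ℕ.≤ length (run n ++ x)
          length-run zero    x = ℕP.≤-refl
          length-run (suc n) x = ℕP.m≤n⇒m≤1+n (length-run n x)

      scale-shw-initial : ∀ N x y → NoLeadingA x → NoLeadingA y → length x ℕ.+ length y ℕ.≤ N →
                          scale ω (shw F G x y) ≃ ((ω x * ω y) · shw F' G' x y)
      scale-shw-initial N       []      y       _   _   _ =
        ∷-cong y (trans (*-identityˡ _) (sym (trans (*-identityʳ _) (*-identityˡ _)))) ≃-refl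
      scale-shw-initial N       (b ∷ x) []      _   _   _ =
        ∷-cong (b ∷ x) (trans (*-identityˡ _) (sym (trans (*-identityʳ _) (*-identityʳ _)))) ≃-refl
      scale-shw-initial (suc N) (b ∷ x) (c ∷ y) b≢a c≢a (ℕ.s≤s bound) = begin
        scale ω ((F b c · (b ◁ A)) ⊕ (G b c · (c ◁ B)))
          ≡⟨ scale-⊕ ω (F b c · (b ◁ A)) (G b c · (c ◁ B)) ⟩
        scale ω (F b c · (b ◁ A)) ⊕ scale ω (G b c · (c ◁ B))
          ≈⟨ ⊕-cong left right ⟩
        ((ω (b ∷ x) * ω (c ∷ y)) · (F' b c · (b ◁ A'))) ⊕ ((ω (b ∷ x) * ω (c ∷ y)) · (G' b c · (c ◁ B')))
          ≡⟨ ·-⊕ (ω (b ∷ x) * ω (c ∷ y)) (F' b c · (b ◁ A')) (G' b c · (c ◁ B')) ⟨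
        (ω (b ∷ x) * ω (c ∷ y)) · ((F' b c · (b ◁ A')) ⊕ (G' b c · (c ◁ B')))
          ∎
        where
        A B A' B' : Poly
        A = shw F G x (c ∷ y); B = shw F G (b ∷ x) y
        A' = shw F' G' x (c ∷ y); B' = shw F' G' (b ∷ x) y
        left : scale ω (F b c · (b ◁ A)) ≃ ((ω (b ∷ x) * ω (c ∷ y)) · (F' b c · (b ◁ A')))
        left = begin
          scale ω (F b c · (b ◁ A))                    ≈⟨ scale-· ω (F b c) (b ◁ A) ⟩
          F b c · scale ω (b ◁ A)                      ≈⟨ ·-congˡ (F b c) (scale-◁ b A b≢a) ⟩
          F b c · (b ◁ scale ω A)                      ≈⟨ ·-congˡ (F b c) (◁-cong b (scale-shw-bounded N x (c ∷ y) bound)) ⟩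
          F b c · (b ◁ ((ω x * ω (c ∷ y)) · A'))       ≡⟨ ≡.cong (F b c ·_) (◁-· b (ω x * ω (c ∷ y)) A') ⟩
          F b c · ((ω x * ω (c ∷ y)) · (b ◁ A'))       ≈⟨ ·-exchange (b ◁ A') (trans (*-comm _ _)
                                                            (*-cong (*-congʳ (sym (ω-other b x b≢a))) (agree₁ b c b≢a c≢a))) ⟩
          (ω (b ∷ x) * ω (c ∷ y)) · (F' b c · (b ◁ A')) ∎
        right : scale ω (G b c · (c ◁ B)) ≃ ((ω (b ∷ x) * ω (c ∷ y)) · (G' b c · (c ◁ B')))
        right = begin
          scale ω (G b c · (c ◁ B))                    ≈⟨ scale-· ω (G b c) (c ◁ B) ⟩
          G b c · scale ω (c ◁ B)                      ≈⟨ ·-congˡ (G b c) (scale-◁ c B c≢a) ⟩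
          G b c · (c ◁ scale ω B)                      ≈⟨ ·-congˡ (G b c) (◁-cong c (scale-shw-bounded N (b ∷ x) y bound″)) ⟩
          G b c · (c ◁ ((ω (b ∷ x) * ω y) · B'))       ≡⟨ ≡.cong (G b c ·_) (◁-· c (ω (b ∷ x) * ω y) B') ⟩
          G b c · ((ω (b ∷ x) * ω y) · (c ◁ B'))       ≈⟨ ·-exchange (c ◁ B') (trans (*-comm _ _)
                                                            (*-cong (*-congˡ (sym (ω-other c y c≢a))) (agree₂ b c b≢a c≢a))) ⟩
          (ω (b ∷ x) * ω (c ∷ y)) · (G' b c · (c ◁ B')) ∎
          where
          bound″ : length (b ∷ x) ℕ.+ length y ℕ.≤ N
          bound″ = ≡.subst (ℕ._≤ N) (ℕP.+-suc (length x) (length y)) bound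

    scale-shw : ∀ u v → scale ω (shw F G u v) ≃ ((ω u * ω v) · shw F' G' u v)
    scale-shw u v = scale-shw-bounded (length u ℕ.+ length v) u v ℕP.≤-refl

module Normalisation {c ℓ : Level} (R : CommutativeRing c ℓ) (isField : IsField R) (charZero : CharZero R)
                     {X : Set} (_≟X_ : DecidableEquality X)
                     (f₁ f₂ : FreeAlg.Coef R _≟X_) (isWeakShuffle : FreeAlg.IsWeakShuffle R _≟X_ f₁ f₂)
                     (a : X) (a∈T : FreeAlg.InT R _≟X_ f₁ a) where
  open CommutativeRing R hiding (zero)
  open FreeAlg R _≟X_
  open Runs R _≟X_ a using (κ)
  open RunWeights R isField charZero _≟X_ a
  open Classification R isField charZero _≟X_ f₁ f₂ isWeakShuffle using (module LetterOfT)
  open LetterOfT a a∈T using (q+p≈1; module Mixed)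
  open import Relation.Binary.Reasoning.Setoid setoid

  f₁' f₂' : Coef
  f₁' = modify a f₁
  f₂' = modify a f₂

  modify-aa : ∀ F → modify a F a a ≡ 1#
  modify-aa F with a ≟X a
  ... | yes _   = ≡.refl
  ... | no  a≢a = ⊥-elim (a≢a ≡.refl)

  modify-left : ∀ F x y → x ≢ a → modify a F x y ≡ F x y
  modify-left F x y x≢a with x ≟X a
  ... | yes x≡a = ⊥-elim (x≢a x≡a)
  ... | no  _   = ≡.refl

  modify-right : ∀ F x y → y ≢ a → modify a F x y ≡ F x y
  modify-right F x y y≢a with x ≟X a | y ≟X a
  ... | yes _ | yes y≡a = ⊥-elim (y≢a y≡a)
  ... | yes _ | no  _   = ≡.refl
  ... | no  _ | _       = ≡.refl

  mixes : ShufflesWithOthers f₁ f₂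
  mixes = record
    { before = λ b b≢a → Mixed.f₁ba≈0 b b≢a , Mixed.f₂ba≈1 b b≢a
    ; after  = λ c c≢a → Mixed.f₁ab≈1 c c≢a , Mixed.f₂ab≈0 c c≢a }

  mixes' : ShufflesWithOthers f₁' f₂'
  mixes' = record
    { before = λ b b≢a → ≡.subst₂ (λ s t → s ≈ 0# × t ≈ 1#) (≡.sym (modify-left f₁ b a b≢a)) (≡.sym (modify-left f₂ b a b≢a))
                           (ShufflesWithOthers.before mixes b b≢a)
    ; after  = λ c c≢a → ≡.subst₂ (λ s t → s ≈ 1# × t ≈ 0#) (≡.sym (modify-right f₁ a c c≢a)) (≡.sym (modify-right f₂ a c c≢a))
                           (ShufflesWithOthers.after mixes c c≢a) }

  -- since q + p = 1, runs of a merge with coefficient 1 under □ …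
  κ≈1 : ∀ n m → κ f₁ f₂ n m ≈ 1#
  κ≈1 zero    m       = refl
  κ≈1 (suc n) zero    = refl
  κ≈1 (suc n) (suc m) =
    trans (+-cong (trans (*-congˡ (κ≈1 n (suc m))) (*-identityʳ _)) (trans (*-congˡ (κ≈1 (suc n) m)) (*-identityʳ _))) q+p≈1

  -- … and, since q' = p' = 1, with binomial coefficients under □'
  κ'-binomial : ∀ n m → n ! * m ! * κ f₁' f₂' n m ≈ (n ℕ.+ m) !
  κ'-binomial zero    m       = trans (*-identityʳ _) (*-identityˡ _)
  κ'-binomial (suc n) zero    = trans (*-identityʳ _) (trans (*-identityʳ _) (≡.subst (λ k → suc n ! ≈ k !) (≡.sym (ℕP.+-identityʳ (suc n))) refl))
  κ'-binomial (suc n) (suc m) = begin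
    suc n ! * suc m ! * (f₁' a a * K₁ + f₂' a a * K₂)
      ≡⟨ ≡.cong₂ (λ s t → suc n ! * suc m ! * (s * K₁ + t * K₂)) (modify-aa f₁) (modify-aa f₂) ⟩
    suc n ! * suc m ! * (1# * K₁ + 1# * K₂)
      ≈⟨ pascal-step (ofℕ R (suc n)) (ofℕ R (suc m)) (n !) (m !) K₁ K₂ ⟩
    ofℕ R (suc n) * (n ! * suc m ! * K₁) + ofℕ R (suc m) * (suc n ! * m ! * K₂)
      ≈⟨ +-cong (*-congˡ (κ'-binomial n (suc m))) (*-congˡ (κ'-binomial (suc n) m)) ⟩
    ofℕ R (suc n) * (n ℕ.+ suc m) ! + ofℕ R (suc m) * (suc n ℕ.+ m) !
      ≡⟨ ≡.cong (λ k → ofℕ R (suc n) * (n ℕ.+ suc m) ! + ofℕ R (suc m) * k !) (≡.sym (ℕP.+-suc n m)) ⟩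
    ofℕ R (suc n) * (n ℕ.+ suc m) ! + ofℕ R (suc m) * (n ℕ.+ suc m) !
      ≈⟨ distribʳ _ _ _ ⟨
    (ofℕ R (suc n) + ofℕ R (suc m)) * (n ℕ.+ suc m) !
      ≈⟨ *-congʳ (ofℕ-+ (suc n) (suc m)) ⟨
    (suc n ℕ.+ suc m) !
      ∎
    where
    ofℕ-+ : ∀ i j → ofℕ R (i ℕ.+ j) ≈ ofℕ R i + ofℕ R j
    ofℕ-+ zero    j = sym (+-identityˡ _)
    ofℕ-+ (suc i) j = trans (+-congˡ (ofℕ-+ i j)) (sym (+-assoc _ _ _))
    K₁ K₂ : Carrier
    K₁ = κ f₁' f₂' n (suc m)
    K₂ = κ f₁' f₂' (suc n) m
    pascal-step : ∀ N M n! m! K₁ K₂ →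
      (N * n!) * (M * m!) * (1# * K₁ + 1# * K₂) ≈ N * (n! * (M * m!) * K₁) + M * ((N * n!) * m! * K₂)
    pascal-step = IntegerSolver.solve R 6 (λ N M n! m! K₁ K₂ →
      (N :* n!) :* (M :* m!) :* (num 1 :* K₁ :+ num 1 :* K₂)
        := N :* (n! :* (M :* m!) :* K₁) :+ M :* ((N :* n!) :* m! :* K₂)) refl
      where open IntegerSolver R using (_:*_; _:+_; _:=_; num)

  agree₁ : ∀ b c → b ≢ a → c ≢ a → f₁ b c ≈ f₁' b c
  agree₁ b c b≢a _ = ≡.subst (f₁ b c ≈_) (≡.sym (modify-left f₁ b c b≢a)) refl

  agree₂ : ∀ b c → b ≢ a → c ≢ a → f₂ b c ≈ f₂' b c
  agree₂ b c b≢a _ = ≡.subst (f₂ b c ≈_) (≡.sym (modify-left f₂ b c b≢a)) refl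

  open Multiplicativity f₁ f₂ f₁' f₂' mixes mixes' κ≈1 κ'-binomial agree₁ agree₂ using (scale-shw)
  open DiagonalRescaling R isField _≟X_ using (rescaling-iso; transport)

  normalise-iso : AlgIso f₁ f₂ f₁' f₂'
  normalise-iso = rescaling-iso ω ω≉0 refl f₁ f₂ f₁' f₂' scale-shw

  normalised-weakShuffle : IsWeakShuffle f₁' f₂'
  normalised-weakShuffle = transport ω ω≉0 refl f₁ f₂ f₁' f₂' scale-shw isWeakShuffle

mainTheorem3 : ∀ {c ℓ : Level} (R : CommutativeRing c ℓ) → IsField R → CharZero R →
    (X : Set) (ι : X → ℕ) (ι-inj : Injective _≡_ _≡_ ι) → X →
    let open FreeAlg R (decEqCountable ι ι-inj) in
    (f₁ f₂ : Coef) → IsWeakShuffle f₁ f₂ →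
    (a : X) → InT f₁ a →
    ((b : X) → InT f₁ b → b ≡ a)
    × IsWeakShuffle (modify a f₁) (modify a f₂)
    × AlgIso f₁ f₂ (modify a f₁) (modify a f₂)
mainTheorem3 R isField charZero X ι ι-inj _ f₁ f₂ isWeakShuffle a a∈T =
    (λ b b∈T → T-subsingleton a a∈T b b∈T)
  , normalised-weakShuffle
  , normalise-iso
  where
  _≟X_ : DecidableEquality X
  _≟X_ = decEqCountable ι ι-inj
  open Classification R isField charZero _≟X_ f₁ f₂ isWeakShuffle using (T-subsingleton)
  open Normalisation R isField charZero _≟X_ f₁ f₂ isWeakShuffle a a∈T using (normalise-iso; normalised-weakShuffle)
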